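{- For every W-logic $\mathsf{WL}$ with corresponding sequent calculus $\mathsf{G.WL}$, and every sequent $\Gamma\Rightarrow\Delta$ (with $\Gamma$ a finite multiset and $\Delta$ a multiset of at most one formula): $\mathsf{G.WL}\vdash\Gamma\Rightarrow\Delta$ if and only if $\mathsf{WL}\vdash \bigwedge\Gamma\to\bigvee\Delta$, where the sequent is read as $\bigvee\Delta$ when $\Gamma$ is empty, and $\bigvee\emptyset$ is $\bot$.
   Context: The language $\mathcal{L}$ consists of the formulas built from a countable set $\mathrm{Atm}$ of propositional variables by $A ::= p \mid \bot \mid A\land A \mid A\lor A \mid A\to A \mid \Box A \mid \Diamond A$; $\top := \bot\to\bot$, $\neg A := A\to\bot$. Axiom schemes and rules (for all $A,B$): (Mon$_\Box$) from $A\to B$ infer $\Box A\to\Box B$; (Mon$_\Diamond$) from $A\to B$ infer $\Diamond A\to\Diamond B$; (C$_\Box$) $\Box A\land\Box B\to\Box(A\land B)$; (K$_\Diamond$) $\Box(A\to B)\to(\Diamond A\to\Diamond B)$; (N$_\Box$) $\Box\top$; (T$_\Box$) $\Box A\to A$; (T$_\Diamond$) $A\to\Diamond A$; (D) $\Box A\to\Diamond A$; (P$_\Diamond$) $\Diamond\top$; (Dual$_\land$) $\neg(\Box A\land\Diamond\neg A)$. The W-logics are obtained by adding to an axiomatisation of intuitionistic propositional logic (all $\mathcal L$-instances, with modus ponens): $\mathsf{WM}$ := Dual$_\land$ + Mon$_\Box$ + Mon$_\Diamond$; $\mathsf{WMN}$ := $\mathsf{WM}$+N$_\Box$; $\mathsf{WMC}$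 := $\mathsf{WM}$+C$_\Box$+K$_\Diamond$; $\mathsf{WK}$ := $\mathsf{WMC}$+N$_\Box$; $\mathsf{WMP}$ := $\mathsf{WM}$+P$_\Diamond$; $\mathsf{WMNP}$ := $\mathsf{WMN}$+P$_\Diamond$; $\mathsf{WMD}$ := $\mathsf{WM}$+D+P$_\Diamond$; $\mathsf{WMND}$ := $\mathsf{WMN}$+D; $\mathsf{WMCD}$ := $\mathsf{WMC}$+D+P$_\Diamond$; $\mathsf{WKD}$ := $\mathsf{WK}$+D; $\mathsf{WMT}$, $\mathsf{WMNT}$, $\mathsf{WMCT}$, $\mathsf{WKT}$ := respectively $\mathsf{WM}$, $\mathsf{WMN}$, $\mathsf{WMC}$, $\mathsf{WK}$ + T$_\Box$ + T$_\Diamond$. $\mathsf{WL}\vdash A$ means $A$ is derivable from axiom instances by modus ponens and the rules of $\mathsf{WL}$. Sequents: $\Gamma\Rightarrow\Delta$, $\Gamma$ a finite multiset of formulas, $\Delta$ a multiset of at most one formula; $\Box\Gamma$ denotes $\{\Box A: A\in\Gamma\}$ as a multiset. In all rules $\Gamma,\Gamma'$ are arbitrary finite multisets and $\Delta$ has at most one formula. Propositional rules: (init) $\Gamma,p\Rightarrow p$ for $p\in\mathrm{Atm}$; (L$\bot$) $\Gamma,\bot\Rightarrow\Delta$; (L$\to$) from $\Gamma,A\to B\Rightarrow A$ and $\Gamma,B\Rightarrow\Delta$ infer $\Gamma,A\to B\Rightarrow\Delta$; (R$\to$) from $\Gamma,A\Rightarrow B$ infer $\Gamma\Rightarrow A\to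 B$; (R$\land$) from $\Gamma\Rightarrow A$ and $\Gamma\Rightarrow B$ infer $\Gamma\Rightarrow A\land B$; (L$\land$) from $\Gamma,A,B\Rightarrow\Delta$ infer $\Gamma,A\land B\Rightarrow\Delta$; (R$\lor$) from $\Gamma\Rightarrow A_i$ infer $\Gamma\Rightarrow A_1\lor A_2$ ($i=1,2$); (L$\lor$) from $\Gamma,A\Rightarrow\Delta$ and $\Gamma,B\Rightarrow\Delta$ infer $\Gamma,A\lor B\Rightarrow\Delta$. Modal rules: (M$_\Box$) from $A\Rightarrow B$ infer $\Gamma,\Box A\Rightarrow\Box B$; (M$_\Diamond$) from $A\Rightarrow B$ infer $\Gamma,\Diamond A\Rightarrow\Diamond B$; (Dual$_M$) from $A,B\Rightarrow$ infer $\Gamma,\Box A,\Diamond B\Rightarrow\Delta$; (N$_\Box$) from $\Rightarrow A$ infer $\Gamma\Rightarrow\Box A$; (N$_\Diamond$) from $A\Rightarrow$ infer $\Gamma,\Diamond A\Rightarrow\Delta$; (C$_\Box$) from $\Gamma,A\Rightarrow B$ infer $\Gamma',\Box\Gamma,\Box A\Rightarrow\Box B$; (C$_\Diamond$) from $\Gamma,A\Rightarrow B$ infer $\Gamma',\Box\Gamma,\Diamond A\Rightarrow\Diamond B$; (Dual$_C$) from $\Gamma,A,B\Rightarrow$ infer $\Gamma',\Box\Gamma,\Box A,\Diamond B\Rightarrow\Delta$; (K$_\Box$) from $\Gamma\Rightarrow A$ infer $\Gamma',\Box\Gamma\Rightarrow\Box A$; (K$_\Diamond$) from $\Gamma,A\Rightarrow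 B$ infer $\Gamma',\Box\Gamma,\Diamond A\Rightarrow\Diamond B$; (Dual$_K$) from $\Gamma,A\Rightarrow$ infer $\Gamma',\Box\Gamma,\Diamond A\Rightarrow\Delta$; (T$_\Box$) from $\Gamma,\Box A,A\Rightarrow\Delta$ infer $\Gamma,\Box A\Rightarrow\Delta$; (T$_\Diamond$) from $\Gamma\Rightarrow A$ infer $\Gamma\Rightarrow\Diamond A$; (P$_\Box$) from $A\Rightarrow$ infer $\Gamma,\Box A\Rightarrow\Delta$; (P$_\Diamond$) from $\Rightarrow A$ infer $\Gamma\Rightarrow\Diamond A$; (D) from $A\Rightarrow B$ infer $\Gamma,\Box A\Rightarrow\Diamond B$; (D$_\Box$) from $A,B\Rightarrow$ infer $\Gamma,\Box A,\Box B\Rightarrow\Delta$; (CD) from $\Gamma\Rightarrow A$ infer $\Gamma',\Box\Gamma\Rightarrow\Diamond A$; (CD$_\Box$) from $\Gamma\Rightarrow$ infer $\Gamma',\Box\Gamma\Rightarrow\Delta$. Each calculus contains all propositional rules plus: $\mathsf{G.WM}$: M$_\Box$, M$_\Diamond$, Dual$_M$; $\mathsf{G.WMP}$: $\mathsf{G.WM}$+P$_\Box$+P$_\Diamond$; $\mathsf{G.WMN}$: $\mathsf{G.WM}$+N$_\Box$+N$_\Diamond$; $\mathsf{G.WMNP}$: $\mathsf{G.WMN}$+P$_\Box$+P$_\Diamond$; $\mathsf{G.WMC}$: C$_\Box$, C$_\Diamond$, Dual$_C$; $\mathsf{G.WK}$: K$_\Box$, K$_\Diamond$, Dual$_K$;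 $\mathsf{G.WMD}$: $\mathsf{G.WM}$+D+D$_\Box$+P$_\Box$+P$_\Diamond$; $\mathsf{G.WMND}$: $\mathsf{G.WMN}$+D+D$_\Box$+P$_\Box$+P$_\Diamond$; $\mathsf{G.WMCD}$: $\mathsf{G.WMC}$+CD+CD$_\Box$; $\mathsf{G.WKD}$: $\mathsf{G.WK}$+CD+CD$_\Box$; $\mathsf{G.WMT}$, $\mathsf{G.WMNT}$, $\mathsf{G.WMCT}$, $\mathsf{G.WKT}$: respectively $\mathsf{G.WM}$, $\mathsf{G.WMN}$, $\mathsf{G.WMC}$, $\mathsf{G.WK}$ + T$_\Box$ + T$_\Diamond$. -}

module Defs where

open import Data.Nat using (ℕ)
open import Data.Bool using (Bool; true; false; T)
open import Data.List using (List; []; _∷_; [_]; map; _++_)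
open import Data.Maybe using (Maybe; just; nothing)
open import Data.List.Relation.Binary.Permutation.Propositional using (_↭_)

infixr 6 _∧_
infixr 5 _∨_
infixr 4 _⊃_
infix 7 □_ ◇_

data Fm : Set where
  var    : ℕ → Fm
  falsum : Fm
  _∧_    : Fm → Fm → Fm
  _∨_    : Fm → Fm → Fm
  _⊃_    : Fm → Fm → Fm
  □_     : Fm → Fm
  ◇_     : Fm → Fm

⊤ᶠ : Fm
⊤ᶠ = falsum ⊃ falsum

¬ᶠ_ : Fm → Fm
¬ᶠ A = A ⊃ falsum

-- The fourteen W-logics (each names both WL and G.WL)

data WL : Set where
  WM WMN WMC WK WMP WMNP WMD WMND WMCD WKD WMT WMNT WMCT WKT : WL

hN : WL → Bool
hN WMN = true
hN WK = true
hN WMNP = true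
hN WMND = true
hN WKD = true
hN WMNT = true
hN WKT = true
hN _ = false

hC : WL → Bool
hC WMC = true
hC WK = true
hC WMCD = true
hC WKD = true
hC WMCT = true
hC WKT = true
hC _ = false

hP : WL → Bool
hP WMP = true
hP WMNP = true
hP WMD = true
hP WMCD = true
hP _ = false

hD : WL → Bool
hD WMD = true
hD WMND = true
hD WMCD = true
hD WKD = true
hD _ = false

hT : WL → Bool
hT WMT = true
hT WMNT = true
hT WMCT = true
hT WKT = true
hT _ = false

infix 2 _⊢H_
data _⊢H_ (L : WL) : Fm → Set where
  ax-K   : ∀ {A B} → L ⊢H A ⊃ (B ⊃ A)
  ax-S   : ∀ {A B C} → L ⊢H (A ⊃ (B ⊃ C)) ⊃ ((A ⊃ B) ⊃ (A ⊃ C))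
  ax-∧E₁ : ∀ {A B} → L ⊢H A ∧ B ⊃ A
  ax-∧E₂ : ∀ {A B} → L ⊢H A ∧ B ⊃ B
  ax-∧I  : ∀ {A B} → L ⊢H A ⊃ (B ⊃ A ∧ B)
  ax-∨I₁ : ∀ {A B} → L ⊢H A ⊃ A ∨ B
  ax-∨I₂ : ∀ {A B} → L ⊢H B ⊃ A ∨ B
  ax-∨E  : ∀ {A B C} → L ⊢H (A ⊃ C) ⊃ ((B ⊃ C) ⊃ (A ∨ B ⊃ C))
  ax-⊥E  : ∀ {A} → L ⊢H falsum ⊃ A
  mp     : ∀ {A B} → L ⊢H A ⊃ B → L ⊢H A → L ⊢H B
  dual∧  : ∀ {A} → L ⊢H ¬ᶠ (□ A ∧ ◇ (¬ᶠ A))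
  mon□   : ∀ {A B} → L ⊢H A ⊃ B → L ⊢H □ A ⊃ □ B
  mon◇   : ∀ {A B} → L ⊢H A ⊃ B → L ⊢H ◇ A ⊃ ◇ B
  axN□   : T (hN L) → L ⊢H □ ⊤ᶠ
  axC□   : ∀ {A B} → T (hC L) → L ⊢H □ A ∧ □ B ⊃ □ (A ∧ B)
  axK◇   : ∀ {A B} → T (hC L) → L ⊢H □ (A ⊃ B) ⊃ (◇ A ⊃ ◇ B)
  axP◇   : T (hP L) → L ⊢H ◇ ⊤ᶠ
  axD    : ∀ {A} → T (hD L) → L ⊢H □ A ⊃ ◇ A
  axT□   : ∀ {A} → T (hT L) → L ⊢H □ A ⊃ A
  axT◇   : ∀ {A} → T (hT L) → L ⊢H A ⊃ ◇ A

gM : WL → Bool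
gM WM = true
gM WMP = true
gM WMN = true
gM WMNP = true
gM WMD = true
gM WMND = true
gM WMT = true
gM WMNT = true
gM _ = false

gP : WL → Bool
gP WMP = true
gP WMNP = true
gP WMD = true
gP WMND = true
gP _ = false

gN : WL → Bool
gN WMN = true
gN WMNP = true
gN WMND = true
gN WMNT = true
gN _ = false

gC : WL → Bool
gC WMC = true
gC WMCD = true
gC WMCT = true
gC _ = false

gK : WL → Bool
gK WK = true
gK WKD = true
gK WKT = true
gK _ = false

gD : WL → Bool
gD WMD = true
gD WMND = true
gD _ = false

gCD : WL → Bool
gCD WMCD = true
gCD WKD = true
gCD _ = false

gT : WL → Bool
gT WMT = true
gT WMNT = true
gT WMCT = true
gT WKT = true
gT _ = false

□* : List Fm → List Fm
□* = map □_

-- Sequents Γ ⇒ Δ: Γ a multiset (list up to permutation), Δ at most one formula.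
-- Every rule's conclusion antecedent Θ is any permutation of the displayed
-- multiset, so derivability is a relation on multisets.
infix 2 _⊢G_⇒_
data _⊢G_⇒_ (L : WL) : List Fm → Maybe Fm → Set where
  init : ∀ {Θ Γ p} → Θ ↭ var p ∷ Γ → L ⊢G Θ ⇒ just (var p)
  L⊥   : ∀ {Θ Γ Δ} → Θ ↭ falsum ∷ Γ → L ⊢G Θ ⇒ Δ
  L⊃   : ∀ {Θ Γ A B Δ} → Θ ↭ (A ⊃ B) ∷ Γ →
         L ⊢G (A ⊃ B) ∷ Γ ⇒ just A → L ⊢G B ∷ Γ ⇒ Δ → L ⊢G Θ ⇒ Δ
  R⊃   : ∀ {Γ A B} → L ⊢G A ∷ Γ ⇒ just B → L ⊢G Γ ⇒ just (A ⊃ B)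
  R∧   : ∀ {Γ A B} → L ⊢G Γ ⇒ just A → L ⊢G Γ ⇒ just B → L ⊢G Γ ⇒ just (A ∧ B)
  L∧   : ∀ {Θ Γ A B Δ} → Θ ↭ (A ∧ B) ∷ Γ → L ⊢G A ∷ B ∷ Γ ⇒ Δ → L ⊢G Θ ⇒ Δ
  R∨₁  : ∀ {Γ A B} → L ⊢G Γ ⇒ just A → L ⊢G Γ ⇒ just (A ∨ B)
  R∨₂  : ∀ {Γ A B} → L ⊢G Γ ⇒ just B → L ⊢G Γ ⇒ just (A ∨ B)
  L∨   : ∀ {Θ Γ A B Δ} → Θ ↭ (A ∨ B) ∷ Γ →
         L ⊢G A ∷ Γ ⇒ Δ → L ⊢G B ∷ Γ ⇒ Δ → L ⊢G Θ ⇒ Δ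
  M□    : ∀ {Θ Γ A B} → T (gM L) → Θ ↭ □ A ∷ Γ →
          L ⊢G [ A ] ⇒ just B → L ⊢G Θ ⇒ just (□ B)
  M◇    : ∀ {Θ Γ A B} → T (gM L) → Θ ↭ ◇ A ∷ Γ →
          L ⊢G [ A ] ⇒ just B → L ⊢G Θ ⇒ just (◇ B)
  DualM : ∀ {Θ Γ A B Δ} → T (gM L) → Θ ↭ □ A ∷ ◇ B ∷ Γ →
          L ⊢G A ∷ B ∷ [] ⇒ nothing → L ⊢G Θ ⇒ Δ
  N□    : ∀ {Γ A} → T (gN L) → L ⊢G [] ⇒ just A → L ⊢G Γ ⇒ just (□ A)
  N◇    : ∀ {Θ Γ A Δ} → T (gN L) → Θ ↭ ◇ A ∷ Γ →
          L ⊢G [ A ] ⇒ nothing → L ⊢G Θ ⇒ Δ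
  C□    : ∀ {Θ Γ Γ' A B} → T (gC L) → Θ ↭ □ A ∷ □* Γ ++ Γ' →
          L ⊢G A ∷ Γ ⇒ just B → L ⊢G Θ ⇒ just (□ B)
  C◇    : ∀ {Θ Γ Γ' A B} → T (gC L) → Θ ↭ ◇ A ∷ □* Γ ++ Γ' →
          L ⊢G A ∷ Γ ⇒ just B → L ⊢G Θ ⇒ just (◇ B)
  DualC : ∀ {Θ Γ Γ' A B Δ} → T (gC L) → Θ ↭ □ A ∷ ◇ B ∷ □* Γ ++ Γ' →
          L ⊢G A ∷ B ∷ Γ ⇒ nothing → L ⊢G Θ ⇒ Δ
  K□    : ∀ {Θ Γ Γ' A} → T (gK L) → Θ ↭ □* Γ ++ Γ' →
          L ⊢G Γ ⇒ just A → L ⊢G Θ ⇒ just (□ A)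
  K◇    : ∀ {Θ Γ Γ' A B} → T (gK L) → Θ ↭ ◇ A ∷ □* Γ ++ Γ' →
          L ⊢G A ∷ Γ ⇒ just B → L ⊢G Θ ⇒ just (◇ B)
  DualK : ∀ {Θ Γ Γ' A Δ} → T (gK L) → Θ ↭ ◇ A ∷ □* Γ ++ Γ' →
          L ⊢G A ∷ Γ ⇒ nothing → L ⊢G Θ ⇒ Δ
  T□    : ∀ {Θ Γ A Δ} → T (gT L) → Θ ↭ □ A ∷ Γ →
          L ⊢G A ∷ □ A ∷ Γ ⇒ Δ → L ⊢G Θ ⇒ Δ
  T◇    : ∀ {Γ A} → T (gT L) → L ⊢G Γ ⇒ just A → L ⊢G Γ ⇒ just (◇ A)
  P□    : ∀ {Θ Γ A Δ} → T (gP L) → Θ ↭ □ A ∷ Γ →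
          L ⊢G [ A ] ⇒ nothing → L ⊢G Θ ⇒ Δ
  P◇    : ∀ {Γ A} → T (gP L) → L ⊢G [] ⇒ just A → L ⊢G Γ ⇒ just (◇ A)
  D     : ∀ {Θ Γ A B} → T (gD L) → Θ ↭ □ A ∷ Γ →
          L ⊢G [ A ] ⇒ just B → L ⊢G Θ ⇒ just (◇ B)
  D□    : ∀ {Θ Γ A B Δ} → T (gD L) → Θ ↭ □ A ∷ □ B ∷ Γ →
          L ⊢G A ∷ B ∷ [] ⇒ nothing → L ⊢G Θ ⇒ Δ
  CD    : ∀ {Θ Γ Γ' A} → T (gCD L) → Θ ↭ □* Γ ++ Γ' →
          L ⊢G Γ ⇒ just A → L ⊢G Θ ⇒ just (◇ A)
  CD□   : ∀ {Θ Γ Γ' Δ} → T (gCD L) → Θ ↭ □* Γ ++ Γ' →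
          L ⊢G Γ ⇒ nothing → L ⊢G Θ ⇒ Δ

⋀ : List Fm → Fm
⋀ [] = ⊤ᶠ
⋀ (A ∷ []) = A
⋀ (A ∷ B ∷ Γ) = A ∧ ⋀ (B ∷ Γ)

⋁ : Maybe Fm → Fm
⋁ nothing = falsum
⋁ (just A) = A

fmla : List Fm → Maybe Fm → Fm
fmla [] Δ = ⋁ Δ
fmla (A ∷ Γ) Δ = ⋀ (A ∷ Γ) ⊃ ⋁ Δ

-- Soundness translates each rule of G.WL into a Hilbert derivation.  For completeness the
-- axioms of WL are derivable sequents and modus ponens is a cut, so everything rests on cut
-- admissibility.  This is proved for a height-bounded copy of G.WL in which every modal rule
-- other than T□ and T◇ is an instance of a single scheme, the calculi differing only in how
-- many boxed formulas the scheme may consume; in each of the fourteen calculi these numbers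
-- are closed under merging two modal rules across a principal cut.  Inversion and contraction
-- preserve height, and cuts are eliminated by induction on the cut formula and the heights.
module Submission where

open import Defs
open import Data.Bool using (T)
open import Data.Empty using (⊥; ⊥-elim)
open import Data.List using (List; []; _∷_; [_]; _++_; length)
open import Data.List.Properties using (map-++; length-++; ++-identityʳ; ++-assoc)
open import Data.List.Membership.Propositional using (_∈_)
open import Data.List.Membership.Propositional.Properties using (∈-∃++; ∈-++⁻; ∈-++⁺ˡ; ∈-++⁺ʳ; ∈-map⁺)
open import Data.List.Relation.Unary.Any using (here; there)
open import Data.List.Relation.Binary.Permutation.Propositional
  using (_↭_; prep; swap; ↭-refl; ↭-sym; ↭-trans; ↭-reflexive)
open import Data.List.Relation.Binary.Permutation.Propositional.Properties
  using ( shift; shifts; drop-∷; ∈-resp-↭; ↭-map-inv; ++⁺ˡ; ++⁺ʳ; ++-comm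
        ; ↭-singleton-inv; ↭-empty-inv; ↭-length; map⁺)
open import Data.Maybe using (Maybe; just; nothing)
open import Data.Nat using (ℕ; zero; suc; _+_)
open import Data.Nat.Properties using (+-comm; +-suc; +-identityʳ)
open import Data.Product using (∃; _,_; _×_)
open import Data.Sum using (_⊎_; inj₁; inj₂)
open import Data.Unit using (⊤; tt)
open import Function.Bundles using (_⇔_; mk⇔)
open import Relation.Binary.PropositionalEquality using (_≡_; refl; sym; cong; subst) renaming (trans to ≡-trans)

infixr 5 _⊙_
_⊙_ : ∀ {xs ys zs : List Fm} → xs ↭ ys → ys ↭ zs → xs ↭ zs
_⊙_ = ↭-trans

∈⇒↭∷ : ∀ {x : Fm} {xs} → x ∈ xs → ∃ λ ys → xs ↭ x ∷ ys
∈⇒↭∷ {x} x∈xs with ys , zs , refl ← ∈-∃++ x∈xs = ys ++ zs , shift x ys zs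

↭-insert : ∀ Q {X : Fm} {Γ Γ₁} → Γ ↭ X ∷ Γ₁ → Q ++ Γ ↭ X ∷ Q ++ Γ₁
↭-insert Q {X} {Γ₁ = Γ₁} τ = ++⁺ˡ Q τ ⊙ shift X Q Γ₁

↭-insert₂ : ∀ Q {X : Fm} {Γ Γ₁} → Γ ↭ X ∷ X ∷ Γ₁ → Q ++ Γ ↭ X ∷ X ∷ Q ++ Γ₁
↭-insert₂ Q ρ = ++⁺ˡ Q ρ ⊙ shifts Q (_ ∷ _ ∷ [])

↭-unshift : ∀ Q {X : Fm} {Γ} → X ∷ Q ++ Γ ↭ Q ++ X ∷ Γ
↭-unshift Q {X} {Γ} = ↭-sym (shift X Q Γ)

↭-∷-inv : ∀ {A P : Fm} {Γ Γ₀} → A ∷ Γ ↭ P ∷ Γ₀ →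
          (A ≡ P × Γ ↭ Γ₀) ⊎ ∃ λ Γ₁ → Γ ↭ P ∷ Γ₁ × Γ₀ ↭ A ∷ Γ₁
↭-∷-inv {A} {P} σ with ∈-resp-↭ (↭-sym σ) (here refl)
... | here refl = inj₁ (refl , drop-∷ σ)
... | there P∈Γ with Γ₁ , τ ← ∈⇒↭∷ P∈Γ =
  inj₂ (Γ₁ , τ , drop-∷ (↭-sym σ ⊙ prep A τ ⊙ swap A P ↭-refl))

↭-∷∷-inv : ∀ {X P : Fm} {Γ Γ₀} → X ∷ X ∷ Γ ↭ P ∷ Γ₀ →
           (X ≡ P × Γ₀ ↭ X ∷ Γ) ⊎ ∃ λ Γ₁ → Γ ↭ P ∷ Γ₁ × Γ₀ ↭ X ∷ X ∷ Γ₁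
↭-∷∷-inv σ with ↭-∷-inv σ
... | inj₁ (e , τ) = inj₁ (e , ↭-sym τ)
... | inj₂ (Γ₁′ , τ , ρ) with ↭-∷-inv τ
...   | inj₁ (e , τ′) = inj₁ (e , ρ ⊙ prep _ (↭-sym τ′))
...   | inj₂ (Γ₁ , τ′ , ρ′) = inj₂ (Γ₁ , τ′ , ρ ⊙ prep _ ρ′)

data Split₃ (A : Fm) (Γ L₁ L₂ L₃ : List Fm) : Set where
  in₁ : ∀ L₁′ → L₁ ↭ A ∷ L₁′ → Γ ↭ L₁′ ++ L₂ ++ L₃ → Split₃ A Γ L₁ L₂ L₃
  in₂ : ∀ L₂′ → L₂ ↭ A ∷ L₂′ → Γ ↭ L₁ ++ L₂′ ++ L₃ → Split₃ A Γ L₁ L₂ L₃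
  in₃ : ∀ L₃′ → L₃ ↭ A ∷ L₃′ → Γ ↭ L₁ ++ L₂ ++ L₃′ → Split₃ A Γ L₁ L₂ L₃

split₃ : ∀ {A Γ} L₁ L₂ L₃ → A ∷ Γ ↭ L₁ ++ L₂ ++ L₃ → Split₃ A Γ L₁ L₂ L₃
split₃ L₁ L₂ L₃ σ with ∈-++⁻ L₁ (∈-resp-↭ σ (here refl))
... | inj₁ A∈L₁ with L₁′ , τ ← ∈⇒↭∷ A∈L₁ = in₁ L₁′ τ (drop-∷ (σ ⊙ ++⁺ʳ _ τ))
... | inj₂ A∈L₂L₃ with ∈-++⁻ L₂ A∈L₂L₃
...   | inj₁ A∈L₂ with L₂′ , τ ← ∈⇒↭∷ A∈L₂ =
  in₂ L₂′ τ (drop-∷ (σ ⊙ ↭-insert L₁ (++⁺ʳ _ τ)))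
...   | inj₂ A∈L₃ with L₃′ , τ ← ∈⇒↭∷ A∈L₃ =
  in₃ L₃′ τ (drop-∷ (σ ⊙ ↭-insert L₁ (↭-insert L₂ τ)))

□*-↭-∷-inv : ∀ {A} S {L′} → □* S ↭ A ∷ L′ →
             ∃ λ C → ∃ λ S′ → A ≡ □ C × S ↭ C ∷ S′ × L′ ↭ □* S′
□*-↭-∷-inv S σ with ↭-map-inv □_ σ
... | C ∷ S′ , refl , τ = C , S′ , refl , τ , ↭-refl

[]-↭-∷-inv : ∀ {A : Fm} {L′} → [] ↭ A ∷ L′ → ⊥
[]-↭-∷-inv σ with () ← ↭-empty-inv (↭-sym σ)

[-]-↭-∷-inv : ∀ {A B : Fm} {L′} → [ B ] ↭ A ∷ L′ → A ≡ B × L′ ≡ []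
[-]-↭-∷-inv σ with refl ← ↭-singleton-inv (↭-sym σ) = refl , refl

-- Every modal rule of every calculus, except T□ and T◇, concludes  P, □S, Γ′ ⇒ Δ  from
-- Q, S ⇒ Δp,  where P/Q is empty or a single ◇Z/Z; the calculi differ only in how
-- many boxed formulas S a rule of each kind may consume.

data Base : Set where
  baseM baseMN baseMC baseK : Base

data Seriality : Set where
  nonserial serialP serialD serialCD : Seriality

base : WL → Base
base WM = baseM
base WMP = baseM
base WMD = baseM
base WMT = baseM
base WMN = baseMN
base WMNP = baseMN
base WMND = baseMN
base WMNT = baseMN
base WMC = baseMC
base WMCD = baseMC
base WMCT = baseMC
base WK = baseK
base WKD = baseK
base WKT = baseK

seriality : WL → Seriality
seriality WMP = serialP
seriality WMNP = serialP
seriality WMD = serialD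
seriality WMND = serialD
seriality WMCD = serialCD
seriality WKD = serialCD
seriality _ = nonserial

-- |S| in  □S ⇒ □B  and in  ◇Z, □S ⇒  (M□, N□, C□, K□ and Dual_M, N◇, Dual_C, Dual_K).
boxArity : Base → ℕ → Set
boxArity baseK _ = ⊤
boxArity baseMC zero = ⊥
boxArity baseMC (suc _) = ⊤
boxArity baseM (suc zero) = ⊤
boxArity baseM _ = ⊥
boxArity baseMN zero = ⊤
boxArity baseMN (suc zero) = ⊤
boxArity baseMN _ = ⊥

-- |S| in  ◇Z, □S ⇒ ◇B  (M◇, C◇, K◇).
diaArity : Base → ℕ → Set
diaArity baseK _ = ⊤
diaArity baseMC _ = ⊤
diaArity baseM zero = ⊤
diaArity baseM _ = ⊥
diaArity baseMN zero = ⊤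
diaArity baseMN _ = ⊥

-- |S| in  □S ⇒ ◇B  (P◇, D, CD).
serial◇Arity : Seriality → ℕ → Set
serial◇Arity serialCD _ = ⊤
serial◇Arity serialD zero = ⊤
serial◇Arity serialD (suc zero) = ⊤
serial◇Arity serialD _ = ⊥
serial◇Arity serialP zero = ⊤
serial◇Arity serialP _ = ⊥
serial◇Arity nonserial _ = ⊥

-- |S| in  □S ⇒  (P□, D□, CD□).  The case S = [] is mere weakening; it is admitted in every
-- serial calculus so that this arity, too, is closed under cuts (Arity-cut□, serial□Arity-cut◇).
serial□Arity : Seriality → ℕ → Set
serial□Arity serialCD _ = ⊤
serial□Arity serialD zero = ⊤
serial□Arity serialD (suc zero) = ⊤
serial□Arity serialD (suc (suc zero)) = ⊤
serial□Arity serialD _ = ⊥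
serial□Arity serialP zero = ⊤
serial□Arity serialP (suc zero) = ⊤
serial□Arity serialP _ = ⊥
serial□Arity nonserial _ = ⊥

data RuleKind : Set where
  □R ◇R ◇Rᴰ ◇L □L : RuleKind

Arity : WL → RuleKind → ℕ → Set
Arity L □R = boxArity (base L)
Arity L ◇R = diaArity (base L)
Arity L ◇L = boxArity (base L)
Arity L ◇Rᴰ = serial◇Arity (seriality L)
Arity L □L = serial□Arity (seriality L)

data Shape : RuleKind → List Fm → List Fm → Maybe Fm → Maybe Fm → Set where
  s□R  : ∀ {B} → Shape □R [] [] (just B) (just (□ B))
  s◇R  : ∀ {Z B} → Shape ◇R [ ◇ Z ] [ Z ] (just B) (just (◇ B))
  s◇Rᴰ : ∀ {B} → Shape ◇Rᴰ [] [] (just B) (just (◇ B))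
  s◇L  : ∀ {Z Δ} → Shape ◇L [ ◇ Z ] [ Z ] nothing Δ
  s□L  : ∀ {Δ} → Shape □L [] [] nothing Δ

Shape-weaken⇒ : ∀ {k P Q Δp Δ} → Shape k P Q Δp nothing → Shape k P Q Δp Δ
Shape-weaken⇒ s◇L = s◇L
Shape-weaken⇒ s□L = s□L

Arity-resp-↭ : ∀ L k {S S′ : List Fm} → S ↭ S′ → Arity L k (length S) → Arity L k (length S′)
Arity-resp-↭ L k S↭S′ = subst (Arity L k) (↭-length S↭S′)

Arity-pred : ∀ L k m → Arity L k (suc (suc m)) → Arity L k (suc m)
Arity-pred L □R m = boxArity-pred (base L) m
  where
  boxArity-pred : ∀ b m → boxArity b (suc (suc m)) → boxArity b (suc m)
  boxArity-pred baseK m _ = tt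
  boxArity-pred baseMC m _ = tt
Arity-pred L ◇L m = Arity-pred L □R m
Arity-pred L ◇R m = diaArity-pred (base L) m
  where
  diaArity-pred : ∀ b m → diaArity b (suc (suc m)) → diaArity b (suc m)
  diaArity-pred baseK m _ = tt
  diaArity-pred baseMC m _ = tt
Arity-pred L ◇Rᴰ m = serial◇Arity-pred (seriality L) m
  where
  serial◇Arity-pred : ∀ s m → serial◇Arity s (suc (suc m)) → serial◇Arity s (suc m)
  serial◇Arity-pred serialCD m _ = tt
Arity-pred L □L m = serial□Arity-pred (seriality L) m
  where
  serial□Arity-pred : ∀ s m → serial□Arity s (suc (suc m)) → serial□Arity s (suc m)
  serial□Arity-pred serialCD m _ = tt
  serial□Arity-pred serialD zero _ = tt

boxArity-1 : ∀ b → boxArity b 1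
boxArity-1 baseM = tt
boxArity-1 baseMN = tt
boxArity-1 baseMC = tt
boxArity-1 baseK = tt

diaArity-0 : ∀ b → diaArity b 0
diaArity-0 baseM = tt
diaArity-0 baseMN = tt
diaArity-0 baseMC = tt
diaArity-0 baseK = tt

-- Cutting □C, concluded from x boxes, against a rule consuming □C and y further boxes
-- yields a rule of the same kind consuming x + y boxes.
Arity-cut□ : ∀ L k x y → boxArity (base L) x → Arity L k (suc y) → Arity L k (x + y)
Arity-cut□ L □R x y = boxArity-cut□ (base L) x y
  where
  boxArity-cut□ : ∀ b x y → boxArity b x → boxArity b (suc y) → boxArity b (x + y)
  boxArity-cut□ baseK x y _ _ = tt
  boxArity-cut□ baseMC (suc x) y _ _ = tt
  boxArity-cut□ baseM (suc zero) zero _ _ = tt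
  boxArity-cut□ baseMN zero zero _ _ = tt
  boxArity-cut□ baseMN (suc zero) zero _ _ = tt
Arity-cut□ L ◇L x y = Arity-cut□ L □R x y
Arity-cut□ L ◇R x y = diaArity-cut□ (base L) x y
  where
  diaArity-cut□ : ∀ b x y → boxArity b x → diaArity b (suc y) → diaArity b (x + y)
  diaArity-cut□ baseK x y _ _ = tt
  diaArity-cut□ baseMC x y _ _ = tt
Arity-cut□ L ◇Rᴰ x y = serial◇Arity-cut□ L x y
  where
  serial◇Arity-cut□ : ∀ L x y → boxArity (base L) x → serial◇Arity (seriality L) (suc y) →
                      serial◇Arity (seriality L) (x + y)
  serial◇Arity-cut□ WMCD x y _ _ = tt
  serial◇Arity-cut□ WKD x y _ _ = tt
  serial◇Arity-cut□ WMD (suc zero) zero _ _ = tt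
  serial◇Arity-cut□ WMND zero zero _ _ = tt
  serial◇Arity-cut□ WMND (suc zero) zero _ _ = tt
Arity-cut□ L □L x y = serial□Arity-cut□ L x y
  where
  serial□Arity-cut□ : ∀ L x y → boxArity (base L) x → serial□Arity (seriality L) (suc y) →
                      serial□Arity (seriality L) (x + y)
  serial□Arity-cut□ WMCD x y _ _ = tt
  serial□Arity-cut□ WKD x y _ _ = tt
  serial□Arity-cut□ WMD (suc zero) zero _ _ = tt
  serial□Arity-cut□ WMD (suc zero) (suc zero) _ _ = tt
  serial□Arity-cut□ WMND zero zero _ _ = tt
  serial□Arity-cut□ WMND zero (suc zero) _ _ = tt
  serial□Arity-cut□ WMND (suc zero) zero _ _ = tt
  serial□Arity-cut□ WMND (suc zero) (suc zero) _ _ = tt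
  serial□Arity-cut□ WMP (suc zero) zero _ _ = tt
  serial□Arity-cut□ WMNP zero zero _ _ = tt
  serial□Arity-cut□ WMNP (suc zero) zero _ _ = tt

diaArity-cut◇ : ∀ b x y → diaArity b x → diaArity b y → diaArity b (x + y)
diaArity-cut◇ baseK x y _ _ = tt
diaArity-cut◇ baseMC x y _ _ = tt
diaArity-cut◇ baseM zero zero _ _ = tt
diaArity-cut◇ baseMN zero zero _ _ = tt

boxArity-cut◇ : ∀ b x y → diaArity b x → boxArity b y → boxArity b (x + y)
boxArity-cut◇ baseK x y _ _ = tt
boxArity-cut◇ baseMC x (suc y) _ _ = subst (boxArity baseMC) (sym (+-suc x y)) tt
boxArity-cut◇ baseM zero (suc zero) _ _ = tt
boxArity-cut◇ baseMN zero zero _ _ = tt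
boxArity-cut◇ baseMN zero (suc zero) _ _ = tt

serial◇Arity-cut◇ : ∀ L x y → serial◇Arity (seriality L) x → diaArity (base L) y →
                    serial◇Arity (seriality L) (x + y)
serial◇Arity-cut◇ WMCD x y _ _ = tt
serial◇Arity-cut◇ WKD x y _ _ = tt
serial◇Arity-cut◇ WMD x zero o _ = subst (serial◇Arity serialD) (sym (+-identityʳ x)) o
serial◇Arity-cut◇ WMND x zero o _ = subst (serial◇Arity serialD) (sym (+-identityʳ x)) o
serial◇Arity-cut◇ WMP x zero o _ = subst (serial◇Arity serialP) (sym (+-identityʳ x)) o
serial◇Arity-cut◇ WMNP x zero o _ = subst (serial◇Arity serialP) (sym (+-identityʳ x)) o

serial□Arity-cut◇ : ∀ L x y → serial◇Arity (seriality L) x → boxArity (base L) y →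
                    serial□Arity (seriality L) (x + y)
serial□Arity-cut◇ WMCD x y _ _ = tt
serial□Arity-cut◇ WKD x y _ _ = tt
serial□Arity-cut◇ WMD zero (suc zero) _ _ = tt
serial□Arity-cut◇ WMD (suc zero) (suc zero) _ _ = tt
serial□Arity-cut◇ WMND zero zero _ _ = tt
serial□Arity-cut◇ WMND zero (suc zero) _ _ = tt
serial□Arity-cut◇ WMND (suc zero) zero _ _ = tt
serial□Arity-cut◇ WMND (suc zero) (suc zero) _ _ = tt
serial□Arity-cut◇ WMP zero (suc zero) _ _ = tt
serial□Arity-cut◇ WMNP zero zero _ _ = tt
serial□Arity-cut◇ WMNP zero (suc zero) _ _ = tt

-- L ⊢[ n ] Θ ⇒ Δ : a derivation of height at most n in a calculus equivalent to G.WL.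
-- The bound is what makes inversion and contraction height-preserving, as cut elimination needs.
infix 2 _⊢[_]_⇒_
data _⊢[_]_⇒_ (L : WL) : ℕ → List Fm → Maybe Fm → Set where
  up   : ∀ {n Θ Δ} → L ⊢[ n ] Θ ⇒ Δ → L ⊢[ suc n ] Θ ⇒ Δ
  init : ∀ {n Θ Γ p} → Θ ↭ var p ∷ Γ → L ⊢[ suc n ] Θ ⇒ just (var p)
  L⊥   : ∀ {n Θ Γ Δ} → Θ ↭ falsum ∷ Γ → L ⊢[ suc n ] Θ ⇒ Δ
  L⊃   : ∀ {n Θ Γ A B Δ} → Θ ↭ (A ⊃ B) ∷ Γ → L ⊢[ n ] (A ⊃ B) ∷ Γ ⇒ just A →
         L ⊢[ n ] B ∷ Γ ⇒ Δ → L ⊢[ suc n ] Θ ⇒ Δ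
  R⊃   : ∀ {n Γ A B} → L ⊢[ n ] A ∷ Γ ⇒ just B → L ⊢[ suc n ] Γ ⇒ just (A ⊃ B)
  R∧   : ∀ {n Γ A B} → L ⊢[ n ] Γ ⇒ just A → L ⊢[ n ] Γ ⇒ just B → L ⊢[ suc n ] Γ ⇒ just (A ∧ B)
  L∧   : ∀ {n Θ Γ A B Δ} → Θ ↭ (A ∧ B) ∷ Γ → L ⊢[ n ] A ∷ B ∷ Γ ⇒ Δ → L ⊢[ suc n ] Θ ⇒ Δ
  R∨₁  : ∀ {n Γ A B} → L ⊢[ n ] Γ ⇒ just A → L ⊢[ suc n ] Γ ⇒ just (A ∨ B)
  R∨₂  : ∀ {n Γ A B} → L ⊢[ n ] Γ ⇒ just B → L ⊢[ suc n ] Γ ⇒ just (A ∨ B)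
  L∨   : ∀ {n Θ Γ A B Δ} → Θ ↭ (A ∨ B) ∷ Γ → L ⊢[ n ] A ∷ Γ ⇒ Δ → L ⊢[ n ] B ∷ Γ ⇒ Δ →
         L ⊢[ suc n ] Θ ⇒ Δ
  mod  : ∀ {n Θ S Γ′ k P Q Δp Δ} → Shape k P Q Δp Δ → Arity L k (length S) →
         Θ ↭ P ++ □* S ++ Γ′ → L ⊢[ n ] Q ++ S ⇒ Δp → L ⊢[ suc n ] Θ ⇒ Δ
  T□   : ∀ {n Θ Γ A Δ} → T (gT L) → Θ ↭ □ A ∷ Γ → L ⊢[ n ] A ∷ □ A ∷ Γ ⇒ Δ → L ⊢[ suc n ] Θ ⇒ Δ
  T◇   : ∀ {n Γ A} → T (gT L) → L ⊢[ n ] Γ ⇒ just A → L ⊢[ suc n ] Γ ⇒ just (◇ A)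

module _ {L : WL} where

  permute : ∀ {n Θ Θ′ Δ} → L ⊢[ n ] Θ ⇒ Δ → Θ ↭ Θ′ → L ⊢[ n ] Θ′ ⇒ Δ
  permute (up d) ρ = up (permute d ρ)
  permute (init σ) ρ = init (↭-sym ρ ⊙ σ)
  permute (L⊥ σ) ρ = L⊥ (↭-sym ρ ⊙ σ)
  permute (L⊃ σ d₁ d₂) ρ = L⊃ (↭-sym ρ ⊙ σ) d₁ d₂
  permute (R⊃ d) ρ = R⊃ (permute d (prep _ ρ))
  permute (R∧ d₁ d₂) ρ = R∧ (permute d₁ ρ) (permute d₂ ρ)
  permute (L∧ σ d) ρ = L∧ (↭-sym ρ ⊙ σ) d
  permute (R∨₁ d) ρ = R∨₁ (permute d ρ)
  permute (R∨₂ d) ρ = R∨₂ (permute d ρ)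
  permute (L∨ σ d₁ d₂) ρ = L∨ (↭-sym ρ ⊙ σ) d₁ d₂
  permute (mod sh o σ d) ρ = mod sh o (↭-sym ρ ⊙ σ) d
  permute (T□ t σ d) ρ = T□ t (↭-sym ρ ⊙ σ) d
  permute (T◇ t d) ρ = T◇ t (permute d ρ)

  weaken : ∀ {n Θ Δ X} → L ⊢[ n ] Θ ⇒ Δ → L ⊢[ n ] X ∷ Θ ⇒ Δ
  weaken-under : ∀ {n Γ Δ X} Q → L ⊢[ n ] Q ++ Γ ⇒ Δ → L ⊢[ n ] Q ++ X ∷ Γ ⇒ Δ
  weaken-under Q d = permute (weaken d) (↭-unshift Q)
  weaken (up d) = up (weaken d)
  weaken (init σ) = init (↭-insert [ _ ] σ)
  weaken (L⊥ σ) = L⊥ (↭-insert [ _ ] σ)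
  weaken (L⊃ σ d₁ d₂) = L⊃ (↭-insert [ _ ] σ) (weaken-under [ _ ] d₁) (weaken-under [ _ ] d₂)
  weaken (R⊃ d) = R⊃ (weaken-under [ _ ] d)
  weaken (R∧ d₁ d₂) = R∧ (weaken d₁) (weaken d₂)
  weaken (L∧ σ d) = L∧ (↭-insert [ _ ] σ) (weaken-under (_ ∷ _ ∷ []) d)
  weaken (R∨₁ d) = R∨₁ (weaken d)
  weaken (R∨₂ d) = R∨₂ (weaken d)
  weaken (L∨ σ d₁ d₂) = L∨ (↭-insert [ _ ] σ) (weaken-under [ _ ] d₁) (weaken-under [ _ ] d₂)
  weaken {X = X} (mod {S = S} {Γ′ = Γ′} {P = P} sh o σ d) =
    mod sh o (prep X σ ⊙ ↭-sym (↭-insert P (shift X (□* S) Γ′))) d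
  weaken (T□ t σ d) = T□ t (↭-insert [ _ ] σ) (weaken-under (_ ∷ _ ∷ []) d)
  weaken (T◇ t d) = T◇ t (weaken d)

  weaken-++ˡ : ∀ {n Γ Δ} Q → L ⊢[ n ] Γ ⇒ Δ → L ⊢[ n ] Q ++ Γ ⇒ Δ
  weaken-++ˡ [] d = d
  weaken-++ˡ (_ ∷ Q) d = weaken (weaken-++ˡ Q d)

  weaken-++ʳ : ∀ {n Γ Δ} Q → L ⊢[ n ] Γ ⇒ Δ → L ⊢[ n ] Γ ++ Q ⇒ Δ
  weaken-++ʳ {Γ = Γ} Q d = permute (weaken-++ˡ Q d) (++-comm Q Γ)

  weaken⇒ : ∀ {n Θ Δ} → L ⊢[ n ] Θ ⇒ nothing → L ⊢[ n ] Θ ⇒ Δ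
  weaken⇒ (up d) = up (weaken⇒ d)
  weaken⇒ (L⊥ σ) = L⊥ σ
  weaken⇒ (L⊃ σ d₁ d₂) = L⊃ σ d₁ (weaken⇒ d₂)
  weaken⇒ (L∧ σ d) = L∧ σ (weaken⇒ d)
  weaken⇒ (L∨ σ d₁ d₂) = L∨ σ (weaken⇒ d₁) (weaken⇒ d₂)
  weaken⇒ (mod sh o σ d) = mod (Shape-weaken⇒ sh) o σ d
  weaken⇒ (T□ t σ d) = T□ t σ (weaken⇒ d)

  weaken-height : ∀ {n Θ Δ} k → L ⊢[ n ] Θ ⇒ Δ → L ⊢[ k + n ] Θ ⇒ Δ
  weaken-height zero d = d
  weaken-height (suc k) d = up (weaken-height k d)

-- Height-preserving inversion and contraction

Shape-◇-inv : ∀ {k P Q Δp Δ X P′} → Shape k P Q Δp Δ → P ↭ X ∷ P′ →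
              ∃ λ Z → X ≡ ◇ Z × P ≡ [ ◇ Z ] × Q ≡ [ Z ] × P′ ≡ []
Shape-◇-inv s□R τ = ⊥-elim ([]-↭-∷-inv τ)
Shape-◇-inv s◇Rᴰ τ = ⊥-elim ([]-↭-∷-inv τ)
Shape-◇-inv s□L τ = ⊥-elim ([]-↭-∷-inv τ)
Shape-◇-inv s◇R τ with refl , refl ← [-]-↭-∷-inv τ = _ , refl , refl , refl , refl
Shape-◇-inv s◇L τ with refl , refl ← [-]-↭-∷-inv τ = _ , refl , refl , refl , refl

-- Invertible X R : the left rule for X has a premise whose new formulas are R.
data Invertible : Fm → List Fm → Set where
  inv∧  : ∀ {A B} → Invertible (A ∧ B) (A ∷ B ∷ [])
  inv∨₁ : ∀ {A B} → Invertible (A ∨ B) [ A ]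
  inv∨₂ : ∀ {A B} → Invertible (A ∨ B) [ B ]
  inv⊃  : ∀ {A B} → Invertible (A ⊃ B) [ B ]

Invertible-side : ∀ {X R k P Q Δp Δ S Γ′ Γ} → Invertible X R → Shape k P Q Δp Δ →
                  X ∷ Γ ↭ P ++ □* S ++ Γ′ → ∃ λ Γ″ → Γ ↭ P ++ □* S ++ Γ″
Invertible-side {S = S} {Γ′ = Γ′} iv sh σ with split₃ _ (□* S) Γ′ σ
... | in₁ _ τ _ with Shape-◇-inv sh τ
Invertible-side () sh σ | in₁ _ _ _ | _ , refl , _
Invertible-side {S = S} iv sh σ | in₂ _ τ _ with □*-↭-∷-inv S τ
Invertible-side () sh σ | in₂ _ _ _ | _ , _ , refl , _
Invertible-side iv sh σ | in₃ Γ″ _ ρ = Γ″ , ρ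

module _ {L : WL} where

  invert : ∀ {X R} n {Θ Γ Δ} → Invertible X R → L ⊢[ n ] Θ ⇒ Δ → Θ ↭ X ∷ Γ → L ⊢[ n ] R ++ Γ ⇒ Δ
  invert zero iv () ρ
  invert (suc n) iv (up d) ρ = up (invert n iv d ρ)
  invert (suc n) iv (init σ) ρ with ↭-∷-inv (↭-sym ρ ⊙ σ)
  invert (suc n) () (init σ) ρ | inj₁ (refl , _)
  ... | inj₂ (_ , τ , _) = init (↭-insert _ τ)
  invert (suc n) iv (L⊥ σ) ρ with ↭-∷-inv (↭-sym ρ ⊙ σ)
  invert (suc n) () (L⊥ σ) ρ | inj₁ (refl , _)
  ... | inj₂ (_ , τ , _) = L⊥ (↭-insert _ τ)
  invert (suc n) iv (L⊃ σ d₁ d₂) ρ with ↭-∷-inv (↭-sym ρ ⊙ σ)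
  invert (suc n) inv⊃ (L⊃ σ d₁ d₂) ρ | inj₁ (refl , τ) = up (permute d₂ (prep _ (↭-sym τ)))
  invert {R = R} (suc n) iv (L⊃ σ d₁ d₂) ρ | inj₂ (_ , τ , ρ′) =
    L⊃ (↭-insert R τ) (permute (invert n iv d₁ (↭-insert [ _ ] ρ′)) (shifts R [ _ ]))
                      (permute (invert n iv d₂ (↭-insert [ _ ] ρ′)) (shifts R [ _ ]))
  invert {R = R} (suc n) iv (R⊃ d) ρ =
    R⊃ (permute (invert n iv d (prep _ ρ ⊙ swap _ _ ↭-refl)) (shifts R [ _ ]))
  invert (suc n) iv (R∧ d₁ d₂) ρ = R∧ (invert n iv d₁ ρ) (invert n iv d₂ ρ)
  invert (suc n) iv (R∨₁ d) ρ = R∨₁ (invert n iv d ρ)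
  invert (suc n) iv (R∨₂ d) ρ = R∨₂ (invert n iv d ρ)
  invert (suc n) iv (L∧ σ d) ρ with ↭-∷-inv (↭-sym ρ ⊙ σ)
  invert (suc n) inv∧ (L∧ σ d) ρ | inj₁ (refl , τ) = up (permute d (prep _ (prep _ (↭-sym τ))))
  invert {R = R} (suc n) iv (L∧ σ d) ρ | inj₂ (_ , τ , ρ′) =
    L∧ (↭-insert R τ) (permute (invert n iv d (↭-insert (_ ∷ _ ∷ []) ρ′)) (shifts R (_ ∷ _ ∷ [])))
  invert (suc n) iv (L∨ σ d₁ d₂) ρ with ↭-∷-inv (↭-sym ρ ⊙ σ)
  invert (suc n) inv∨₁ (L∨ σ d₁ d₂) ρ | inj₁ (refl , τ) = up (permute d₁ (prep _ (↭-sym τ)))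
  invert (suc n) inv∨₂ (L∨ σ d₁ d₂) ρ | inj₁ (refl , τ) = up (permute d₂ (prep _ (↭-sym τ)))
  invert {R = R} (suc n) iv (L∨ σ d₁ d₂) ρ | inj₂ (_ , τ , ρ′) =
    L∨ (↭-insert R τ) (permute (invert n iv d₁ (↭-insert [ _ ] ρ′)) (shifts R [ _ ]))
                      (permute (invert n iv d₂ (↭-insert [ _ ] ρ′)) (shifts R [ _ ]))
  invert {R = R} (suc n) iv (mod {S = S} {P = P} sh o σ d) ρ
    with Γ″ , ρ′ ← Invertible-side iv sh (↭-sym ρ ⊙ σ) =
    mod sh o (++⁺ˡ R ρ′ ⊙ shifts R P ⊙ ++⁺ˡ P (shifts R (□* S))) d
  invert (suc n) iv (T□ t σ d) ρ with ↭-∷-inv (↭-sym ρ ⊙ σ)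
  invert (suc n) () (T□ t σ d) ρ | inj₁ (refl , _)
  ... | inj₂ (_ , τ , ρ′) =
    T□ t (↭-insert _ τ) (permute (invert n iv d (↭-insert (_ ∷ _ ∷ []) ρ′)) (shifts _ (_ ∷ _ ∷ [])))
  invert (suc n) iv (T◇ t d) ρ = T◇ t (invert n iv d ρ)

data ModalCopies (X : Fm) (Γ P S Γ′ : List Fm) : Set where
  side-copy    : ∀ Γ″ → X ∷ Γ ↭ P ++ □* S ++ Γ″ → ModalCopies X Γ P S Γ′
  boxed-copies : ∀ C S″ → X ≡ □ C → S ↭ C ∷ C ∷ S″ → Γ ↭ P ++ □* S″ ++ Γ′ → ModalCopies X Γ P S Γ′

modalCopies : ∀ {k P Q Δp Δ X Γ} S Γ′ → Shape k P Q Δp Δ → X ∷ X ∷ Γ ↭ P ++ □* S ++ Γ′ →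
              ModalCopies X Γ P S Γ′
modalCopies {P = P} S Γ′ sh σ with split₃ P (□* S) Γ′ σ
... | in₃ Γ″ _ ρ = side-copy Γ″ ρ
... | in₁ _ τ ρ with Shape-◇-inv sh τ
...   | _ , refl , refl , _ , refl with split₃ [] (□* S) Γ′ ρ
...     | in₁ _ τ′ _ = ⊥-elim ([]-↭-∷-inv τ′)
...     | in₂ _ τ′ _ with □*-↭-∷-inv S τ′
...       | _ , _ , () , _
modalCopies S Γ′ sh σ | in₁ _ τ ρ | _ , refl , refl , _ , refl | in₃ Γ″ _ ρ′ = side-copy Γ″ (prep _ ρ′)
modalCopies {P = P} S Γ′ sh σ | in₂ _ τ ρ with □*-↭-∷-inv S τ
... | C , S′ , refl , μ , ν with split₃ P (□* S′) Γ′ (ρ ⊙ ++⁺ˡ P (++⁺ʳ Γ′ ν))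
...   | in₁ _ τ′ _ with Shape-◇-inv sh τ′
...     | _ , () , _
modalCopies {P = P} S Γ′ sh σ | in₂ _ τ ρ | C , S′ , refl , μ , ν | in₂ _ τ′ ρ′ with □*-↭-∷-inv S′ τ′
... | _ , S″ , refl , μ′ , ν′ = boxed-copies C S″ refl (μ ⊙ prep C μ′) (ρ′ ⊙ ++⁺ˡ P (++⁺ʳ Γ′ ν′))
modalCopies {P = P} S Γ′ sh σ | in₂ _ τ ρ | C , S′ , refl , μ , ν | in₃ Γ″ _ ρ′ =
  side-copy Γ″ (prep _ ρ′ ⊙ ↭-unshift P ⊙ ++⁺ˡ P (++⁺ʳ Γ″ (map⁺ □_ (↭-sym μ))))

module _ {L : WL} where

  contract : ∀ n {Θ Γ X Δ} → L ⊢[ n ] Θ ⇒ Δ → Θ ↭ X ∷ X ∷ Γ → L ⊢[ n ] X ∷ Γ ⇒ Δ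
  contract-under : ∀ n Q {Θ Γ₁ Γ₂ X Δ} → L ⊢[ n ] Θ ⇒ Δ → Θ ↭ Q ++ Γ₁ → Γ₁ ↭ X ∷ X ∷ Γ₂ →
                   L ⊢[ n ] Q ++ X ∷ Γ₂ ⇒ Δ
  contract-under n Q d e ρ = permute (contract n d (e ⊙ ↭-insert₂ Q ρ)) (↭-unshift Q)

  contract zero () ρ
  contract (suc n) (up d) ρ = up (contract n d ρ)
  contract (suc n) (init σ) ρ with ↭-∷∷-inv (↭-sym ρ ⊙ σ)
  ... | inj₁ (refl , τ) = init ↭-refl
  ... | inj₂ (_ , τ , _) = init (↭-insert [ _ ] τ)
  contract (suc n) (L⊥ σ) ρ with ↭-∷∷-inv (↭-sym ρ ⊙ σ)
  ... | inj₁ (refl , τ) = L⊥ ↭-refl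
  ... | inj₂ (_ , τ , _) = L⊥ (↭-insert [ _ ] τ)
  contract (suc n) (L⊃ {B = B} σ d₁ d₂) ρ with ↭-∷∷-inv (↭-sym ρ ⊙ σ)
  ... | inj₁ (refl , τ) =
    L⊃ ↭-refl (contract n d₁ (prep _ τ))
              (contract n (invert n inv⊃ d₂ (prep B τ ⊙ swap B _ ↭-refl)) ↭-refl)
  ... | inj₂ (_ , τ , ρ′) =
    L⊃ (↭-insert [ _ ] τ) (contract-under n [ _ ] d₁ ↭-refl ρ′) (contract-under n [ _ ] d₂ ↭-refl ρ′)
  contract (suc n) (R⊃ d) ρ = R⊃ (contract-under n [ _ ] d (prep _ ρ) ↭-refl)
  contract (suc n) (R∧ d₁ d₂) ρ = R∧ (contract n d₁ ρ) (contract n d₂ ρ)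
  contract (suc n) (R∨₁ d) ρ = R∨₁ (contract n d ρ)
  contract (suc n) (R∨₂ d) ρ = R∨₂ (contract n d ρ)
  contract (suc n) (L∧ {A = A} {B = B} σ d) ρ with ↭-∷∷-inv (↭-sym ρ ⊙ σ)
  ... | inj₁ (refl , τ) =
    L∧ ↭-refl (permute (contract n (contract n (invert n inv∧ d (↭-insert (A ∷ B ∷ []) τ))
                                               (prep A (swap B A ↭-refl)))
                                   (swap A B ↭-refl ⊙ prep B (swap A B ↭-refl)))
                       (swap B A ↭-refl))
  ... | inj₂ (_ , τ , ρ′) = L∧ (↭-insert [ _ ] τ) (contract-under n (_ ∷ _ ∷ []) d ↭-refl ρ′)
  contract (suc n) (L∨ {A = A} {B = B} σ d₁ d₂) ρ with ↭-∷∷-inv (↭-sym ρ ⊙ σ)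
  ... | inj₁ (refl , τ) =
    L∨ ↭-refl (contract n (invert n inv∨₁ d₁ (↭-insert [ A ] τ)) ↭-refl)
              (contract n (invert n inv∨₂ d₂ (↭-insert [ B ] τ)) ↭-refl)
  ... | inj₂ (_ , τ , ρ′) =
    L∨ (↭-insert [ _ ] τ) (contract-under n [ _ ] d₁ ↭-refl ρ′) (contract-under n [ _ ] d₂ ↭-refl ρ′)
  contract (suc n) (mod {S = S} {Γ′ = Γ′} {k = k} {P = P} {Q = Q} sh o σ d) ρ
    with modalCopies S Γ′ sh (↭-sym ρ ⊙ σ)
  ... | side-copy Γ″ ρ′ = mod sh o ρ′ d
  ... | boxed-copies C S″ refl μ ρ′ =
    mod {S = C ∷ S″} sh (Arity-pred L k (length S″) (Arity-resp-↭ L k μ o)) (prep _ ρ′ ⊙ ↭-unshift P)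
        (contract-under n Q d (++⁺ˡ Q μ) ↭-refl)
  contract (suc n) (T□ {A = A} t σ d) ρ with ↭-∷∷-inv (↭-sym ρ ⊙ σ)
  ... | inj₁ (refl , τ) =
    T□ t ↭-refl (permute (contract n d (prep A (prep _ τ) ⊙ shifts [ A ] (_ ∷ _ ∷ []))) (swap _ A ↭-refl))
  ... | inj₂ (_ , τ , ρ′) = T□ t (↭-insert [ _ ] τ) (contract-under n (_ ∷ _ ∷ []) d ↭-refl ρ′)
  contract (suc n) (T◇ t d) ρ = T◇ t (contract n d ρ)

-- Derivability with the height hidden; primed names are the rules at that level

infix 2 _⊢_⇒_
_⊢_⇒_ : WL → List Fm → Maybe Fm → Set
L ⊢ Θ ⇒ Δ = ∃ λ n → L ⊢[ n ] Θ ⇒ Δ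

module _ {L : WL} where

  same-height : ∀ {n₁ n₂ Θ₁ Θ₂ Δ₁ Δ₂} → L ⊢[ n₁ ] Θ₁ ⇒ Δ₁ → L ⊢[ n₂ ] Θ₂ ⇒ Δ₂ →
                (L ⊢[ n₁ + n₂ ] Θ₁ ⇒ Δ₁) × (L ⊢[ n₁ + n₂ ] Θ₂ ⇒ Δ₂)
  same-height {n₁} {n₂} {Θ₁} {Δ₁ = Δ₁} d₁ d₂ =
    subst (λ k → L ⊢[ k ] Θ₁ ⇒ Δ₁) (+-comm n₂ n₁) (weaken-height n₂ d₁) , weaken-height n₁ d₂

  permute′ : ∀ {Θ Θ′ Δ} → L ⊢ Θ ⇒ Δ → Θ ↭ Θ′ → L ⊢ Θ′ ⇒ Δ
  permute′ (n , d) ρ = n , permute d ρ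

  weaken′ : ∀ {Θ Δ X} → L ⊢ Θ ⇒ Δ → L ⊢ X ∷ Θ ⇒ Δ
  weaken′ (n , d) = n , weaken d

  weaken-++ˡ′ : ∀ {Θ Δ} Q → L ⊢ Θ ⇒ Δ → L ⊢ Q ++ Θ ⇒ Δ
  weaken-++ˡ′ Q (n , d) = n , weaken-++ˡ Q d

  weaken⇒′ : ∀ {Θ Δ} → L ⊢ Θ ⇒ nothing → L ⊢ Θ ⇒ Δ
  weaken⇒′ (n , d) = n , weaken⇒ d

  contract′ : ∀ {P Γ Γ₀ Δ} → L ⊢ P ∷ Γ ⇒ Δ → Γ ↭ P ∷ Γ₀ → L ⊢ Γ ⇒ Δ
  contract′ (n , d) τ = n , permute (contract n d (prep _ τ)) (↭-sym τ)

  L⊥′ : ∀ {Γ Δ} → L ⊢ falsum ∷ Γ ⇒ Δ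
  L⊥′ = 1 , L⊥ ↭-refl

  L⊃′ : ∀ {Θ Γ A B Δ} → Θ ↭ (A ⊃ B) ∷ Γ → L ⊢ (A ⊃ B) ∷ Γ ⇒ just A → L ⊢ B ∷ Γ ⇒ Δ → L ⊢ Θ ⇒ Δ
  L⊃′ σ (n₁ , d₁) (n₂ , d₂) with e₁ , e₂ ← same-height d₁ d₂ = suc (n₁ + n₂) , L⊃ σ e₁ e₂

  L∨′ : ∀ {Θ Γ A B Δ} → Θ ↭ (A ∨ B) ∷ Γ → L ⊢ A ∷ Γ ⇒ Δ → L ⊢ B ∷ Γ ⇒ Δ → L ⊢ Θ ⇒ Δ
  L∨′ σ (n₁ , d₁) (n₂ , d₂) with e₁ , e₂ ← same-height d₁ d₂ = suc (n₁ + n₂) , L∨ σ e₁ e₂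

  R∧′ : ∀ {Γ A B} → L ⊢ Γ ⇒ just A → L ⊢ Γ ⇒ just B → L ⊢ Γ ⇒ just (A ∧ B)
  R∧′ (n₁ , d₁) (n₂ , d₂) with e₁ , e₂ ← same-height d₁ d₂ = suc (n₁ + n₂) , R∧ e₁ e₂

  L∧′ : ∀ {Θ Γ A B Δ} → Θ ↭ (A ∧ B) ∷ Γ → L ⊢ A ∷ B ∷ Γ ⇒ Δ → L ⊢ Θ ⇒ Δ
  L∧′ σ (n , d) = suc n , L∧ σ d

  R⊃′ : ∀ {Γ A B} → L ⊢ A ∷ Γ ⇒ just B → L ⊢ Γ ⇒ just (A ⊃ B)
  R⊃′ (n , d) = suc n , R⊃ d

  R∨₁′ : ∀ {Γ A B} → L ⊢ Γ ⇒ just A → L ⊢ Γ ⇒ just (A ∨ B)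
  R∨₁′ (n , d) = suc n , R∨₁ d

  R∨₂′ : ∀ {Γ A B} → L ⊢ Γ ⇒ just B → L ⊢ Γ ⇒ just (A ∨ B)
  R∨₂′ (n , d) = suc n , R∨₂ d

  mod′ : ∀ {Θ S Γ′ k P Q Δp Δ} → Shape k P Q Δp Δ → Arity L k (length S) →
         Θ ↭ P ++ □* S ++ Γ′ → L ⊢ Q ++ S ⇒ Δp → L ⊢ Θ ⇒ Δ
  mod′ sh o σ (n , d) = suc n , mod sh o σ d

  T□′ : ∀ {Θ Γ A Δ} → T (gT L) → Θ ↭ □ A ∷ Γ → L ⊢ A ∷ □ A ∷ Γ ⇒ Δ → L ⊢ Θ ⇒ Δ
  T□′ t σ (n , d) = suc n , T□ t σ d

  T◇′ : ∀ {Γ A} → T (gT L) → L ⊢ Γ ⇒ just A → L ⊢ Γ ⇒ just (◇ A)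
  T◇′ t (n , d) = suc n , T◇ t d

  identity : ∀ A Γ → L ⊢ A ∷ Γ ⇒ just A
  identity (var p) Γ = 1 , init ↭-refl
  identity falsum Γ = L⊥′
  identity (A ⊃ B) Γ =
    R⊃′ (L⊃′ (swap _ _ ↭-refl) (permute′ (identity A ((A ⊃ B) ∷ Γ)) (swap _ _ ↭-refl)) (identity B (A ∷ Γ)))
  identity (A ∧ B) Γ = L∧′ ↭-refl (R∧′ (identity A (B ∷ Γ)) (permute′ (identity B (A ∷ Γ)) (swap _ _ ↭-refl)))
  identity (A ∨ B) Γ = L∨′ ↭-refl (R∨₁′ (identity A Γ)) (R∨₂′ (identity B Γ))
  identity (□ A) Γ = mod′ {S = [ A ]} s□R (boxArity-1 (base L)) ↭-refl (identity A [])
  identity (◇ A) Γ = mod′ {S = []} s◇R (diaArity-0 (base L)) ↭-refl (identity A [])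

  T□* : T (gT L) → ∀ S {Γ Γ″ Δ} → L ⊢ S ++ Γ ⇒ Δ → Γ ↭ □* S ++ Γ″ → L ⊢ Γ ⇒ Δ
  T□* t [] g τ = g
  T□* t (Y ∷ S) g τ =
    T□* t S (T□′ t (↭-insert S τ) (permute′ g (prep Y (↭-insert S τ)))) (τ ⊙ ↭-unshift (□* S))

  contract* : ∀ Γ S Γ″ {Δ} → L ⊢ Γ ++ S ⇒ Δ → Γ ↭ S ++ Γ″ → L ⊢ Γ ⇒ Δ
  contract* Γ [] Γ″ g τ = permute′ g (↭-reflexive (++-identityʳ Γ))
  contract* Γ (Y ∷ S) Γ″ (n , d) τ =
    contract* Γ S (Y ∷ Γ″)
      (n , permute (contract n d (↭-sym (↭-unshift Γ) ⊙ prep Y (++⁺ʳ S τ))) (++⁺ʳ S (↭-sym τ)))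
      (τ ⊙ ↭-unshift S)

-- Cut admissibility

↭-exchange : ∀ Q {P A : Fm} {Γ Γ₀ Γ₁} → Γ ↭ P ∷ Γ₁ → Γ₀ ↭ A ∷ Γ₁ → P ∷ Q ++ Γ₀ ↭ A ∷ Q ++ Γ
↭-exchange Q {P} {A} τ ρ = prep P (↭-insert Q ρ) ⊙ swap P A ↭-refl ⊙ prep A (↭-sym (↭-insert Q τ))

□*-++ : ∀ S₁ S₂ Γ → □* S₁ ++ □* S₂ ++ Γ ≡ □* (S₁ ++ S₂) ++ Γ
□*-++ S₁ S₂ Γ = ≡-trans (sym (++-assoc (□* S₁) (□* S₂) Γ)) (cong (_++ Γ) (sym (map-++ □_ S₁ S₂)))

module _ {L : WL} where

  data RightIntro (n : ℕ) (Γ : List Fm) : Fm → Set where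
    intro⊃   : ∀ {X Y} → L ⊢[ n ] X ∷ Γ ⇒ just Y → RightIntro n Γ (X ⊃ Y)
    intro∧   : ∀ {X Y} → L ⊢[ n ] Γ ⇒ just X → L ⊢[ n ] Γ ⇒ just Y → RightIntro n Γ (X ∧ Y)
    intro∨₁  : ∀ {X Y} → L ⊢[ n ] Γ ⇒ just X → RightIntro n Γ (X ∨ Y)
    intro∨₂  : ∀ {X Y} → L ⊢[ n ] Γ ⇒ just Y → RightIntro n Γ (X ∨ Y)
    intro□R  : ∀ {S Γ′ C} → boxArity (base L) (length S) → Γ ↭ □* S ++ Γ′ →
               L ⊢[ n ] S ⇒ just C → RightIntro n Γ (□ C)
    intro◇R  : ∀ {S Γ′ Z C} → diaArity (base L) (length S) → Γ ↭ ◇ Z ∷ □* S ++ Γ′ →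
               L ⊢[ n ] Z ∷ S ⇒ just C → RightIntro n Γ (◇ C)
    intro◇Rᴰ : ∀ {S Γ′ C} → serial◇Arity (seriality L) (length S) → Γ ↭ □* S ++ Γ′ →
               L ⊢[ n ] S ⇒ just C → RightIntro n Γ (◇ C)
    introT◇  : ∀ {C} → T (gT L) → L ⊢[ n ] Γ ⇒ just C → RightIntro n Γ (◇ C)

  RightIntro⇒⊢ : ∀ {n Γ A} → RightIntro n Γ A → L ⊢[ suc n ] Γ ⇒ just A
  RightIntro⇒⊢ (intro⊃ d) = R⊃ d
  RightIntro⇒⊢ (intro∧ d₁ d₂) = R∧ d₁ d₂
  RightIntro⇒⊢ (intro∨₁ d) = R∨₁ d
  RightIntro⇒⊢ (intro∨₂ d) = R∨₂ d
  RightIntro⇒⊢ (intro□R o τ d) = mod s□R o τ d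
  RightIntro⇒⊢ (intro◇R o τ d) = mod s◇R o τ d
  RightIntro⇒⊢ (intro◇Rᴰ o τ d) = mod s◇Rᴰ o τ d
  RightIntro⇒⊢ (introT◇ t d) = T◇ t d

  weaken-RightIntro : ∀ {n Γ A X} → RightIntro n Γ A → RightIntro n (X ∷ Γ) A
  weaken-RightIntro (intro⊃ d) = intro⊃ (weaken-under [ _ ] d)
  weaken-RightIntro (intro∧ d₁ d₂) = intro∧ (weaken d₁) (weaken d₂)
  weaken-RightIntro (intro∨₁ d) = intro∨₁ (weaken d)
  weaken-RightIntro (intro∨₂ d) = intro∨₂ (weaken d)
  weaken-RightIntro (intro□R {S = S} o τ d) = intro□R o (prep _ τ ⊙ ↭-unshift (□* S)) d
  weaken-RightIntro (intro◇R {S = S} o τ d) = intro◇R o (prep _ τ ⊙ swap _ _ ↭-refl ⊙ prep _ (↭-unshift (□* S))) d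
  weaken-RightIntro (intro◇Rᴰ {S = S} o τ d) = intro◇Rᴰ o (prep _ τ ⊙ ↭-unshift (□* S)) d
  weaken-RightIntro (introT◇ t d) = introT◇ t (weaken d)

  data LeftIntro (Γ : List Fm) (Δ : Maybe Fm) : Fm → Set where
    elim∧  : ∀ {X Y} → L ⊢ X ∷ Y ∷ Γ ⇒ Δ → LeftIntro Γ Δ (X ∧ Y)
    elim∨  : ∀ {X Y} → L ⊢ X ∷ Γ ⇒ Δ → L ⊢ Y ∷ Γ ⇒ Δ → LeftIntro Γ Δ (X ∨ Y)
    elim⊃  : ∀ {X Y} → L ⊢ Γ ⇒ just X → L ⊢ Y ∷ Γ ⇒ Δ → LeftIntro Γ Δ (X ⊃ Y)
    elimT□ : ∀ {C} → T (gT L) → L ⊢ C ∷ Γ ⇒ Δ → LeftIntro Γ Δ (□ C)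
    elim□  : ∀ {k P Q Δp S′ Γ′ C} → Shape k P Q Δp Δ → Arity L k (suc (length S′)) →
             Γ ↭ P ++ □* S′ ++ Γ′ → L ⊢ Q ++ C ∷ S′ ⇒ Δp → LeftIntro Γ Δ (□ C)
    elim◇  : ∀ {k Δp S Γ′ C} → Shape k [ ◇ C ] [ C ] Δp Δ → Arity L k (length S) →
             Γ ↭ □* S ++ Γ′ → L ⊢ C ∷ S ⇒ Δp → LeftIntro Γ Δ (◇ C)

  -- The principal modal cuts: the two modal rules merge into one whose boxes are the union
  -- of both rules' boxes, followed by contraction of the boxes the conclusion already has.

  principal-□R : ∀ {k P Q Δp Δ Γ S₁ S′ Γ′ Γ₁′} → Shape k P Q Δp Δ → boxArity (base L) (length S₁) →
                 Arity L k (suc (length S′)) → Γ ↭ □* S₁ ++ Γ₁′ → Γ ↭ P ++ □* S′ ++ Γ′ →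
                 L ⊢ Q ++ S₁ ++ S′ ⇒ Δp → L ⊢ Γ ⇒ Δ
  principal-□R {k} {P} {Γ = Γ} {S₁} {S′} {Γ′} {Γ₁′} sh o₁ o τ σ g =
    contract* Γ (□* S₁) Γ₁′ (mod′ sh arity context g) τ
    where
    arity : Arity L k (length (S₁ ++ S′))
    arity = subst (Arity L k) (sym (length-++ S₁)) (Arity-cut□ L k _ _ o₁ o)
    context : Γ ++ □* S₁ ↭ P ++ □* (S₁ ++ S′) ++ Γ′
    context = ++-comm Γ (□* S₁) ⊙ ++⁺ˡ (□* S₁) σ ⊙ shifts (□* S₁) P ⊙ ++⁺ˡ P (↭-reflexive (□*-++ S₁ S′ Γ′))

  merge-◇ : ∀ {k P Q Δp Δ Γ S₁ S Γ′ Γ₁′} → Shape k P Q Δp Δ → Arity L k (length S₁ + length S) →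
            Γ ↭ P ++ □* S₁ ++ Γ₁′ → Γ ↭ □* S ++ Γ′ → L ⊢ Q ++ S₁ ++ S ⇒ Δp → L ⊢ Γ ⇒ Δ
  merge-◇ {k} {P} {Γ = Γ} {S₁} {S} {Γ′} {Γ₁′} sh o τ σ g =
    contract* Γ (□* S) Γ′ (mod′ sh (subst (Arity L k) (sym (length-++ S₁)) o) context g) σ
    where
    context : Γ ++ □* S ↭ P ++ □* (S₁ ++ S) ++ Γ₁′
    context = ++⁺ʳ (□* S) τ ⊙ ↭-reflexive (++-assoc P (□* S₁ ++ Γ₁′) (□* S))
              ⊙ ++⁺ˡ P (↭-reflexive (++-assoc (□* S₁) Γ₁′ (□* S)) ⊙ ++⁺ˡ (□* S₁) (++-comm Γ₁′ (□* S))
                        ⊙ ↭-reflexive (□*-++ S₁ S Γ₁′))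

  principal-◇R : ∀ {k X C Δp Δ Γ S₁ S Γ′ Γ₁′} → Shape k [ ◇ C ] [ C ] Δp Δ →
                 diaArity (base L) (length S₁) → Arity L k (length S) → Γ ↭ ◇ X ∷ □* S₁ ++ Γ₁′ →
                 Γ ↭ □* S ++ Γ′ → L ⊢ X ∷ S₁ ++ S ⇒ Δp → L ⊢ Γ ⇒ Δ
  principal-◇R {S₁ = S₁} {S} s◇R o₁ o = merge-◇ {S₁ = S₁} {S} s◇R (diaArity-cut◇ (base L) _ _ o₁ o)
  principal-◇R {S₁ = S₁} {S} s◇L o₁ o = merge-◇ {S₁ = S₁} {S} s◇L (boxArity-cut◇ (base L) _ _ o₁ o)

  principal-◇Rᴰ : ∀ {k C Δp Δ Γ S₁ S Γ′ Γ₁′} → Shape k [ ◇ C ] [ C ] Δp Δ →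
                  serial◇Arity (seriality L) (length S₁) → Arity L k (length S) → Γ ↭ □* S₁ ++ Γ₁′ →
                  Γ ↭ □* S ++ Γ′ → L ⊢ S₁ ++ S ⇒ Δp → L ⊢ Γ ⇒ Δ
  principal-◇Rᴰ {S₁ = S₁} {S} s◇R o₁ o = merge-◇ {S₁ = S₁} {S} s◇Rᴰ (serial◇Arity-cut◇ L _ _ o₁ o)
  principal-◇Rᴰ {S₁ = S₁} {S} s◇L o₁ o = merge-◇ {S₁ = S₁} {S} s□L (serial□Arity-cut◇ L _ _ o₁ o)

  principal-T◇ : ∀ {k C Δp Δ Γ S Γ′} → T (gT L) → Shape k [ ◇ C ] [ C ] Δp Δ → Γ ↭ □* S ++ Γ′ →
                 L ⊢ S ++ Γ ⇒ Δp → L ⊢ Γ ⇒ Δ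
  principal-T◇ {S = S} t s◇R σ g = T◇′ t (T□* t S g σ)
  principal-T◇ {S = S} t s◇L σ g = weaken⇒′ (T□* t S g σ)

  -- Induction on the cut formula, then on the height of the left premise (cut), then on
  -- the height of the right premise once the left one ends in a right rule (cut-RightIntro).
  cut : ∀ A n {Γ Δ} → L ⊢[ n ] Γ ⇒ just A → ∀ m {Θ} → L ⊢[ m ] Θ ⇒ Δ → Θ ↭ A ∷ Γ → L ⊢ Γ ⇒ Δ
  cut-RightIntro : ∀ A n {Γ Δ} → RightIntro n Γ A → ∀ m {Θ} → L ⊢[ m ] Θ ⇒ Δ → Θ ↭ A ∷ Γ → L ⊢ Γ ⇒ Δ
  cut-principal : ∀ A n {Γ Δ} → RightIntro n Γ A → LeftIntro Γ Δ A → L ⊢ Γ ⇒ Δ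

  cut′ : ∀ A {Γ Δ} → L ⊢ Γ ⇒ just A → L ⊢ A ∷ Γ ⇒ Δ → L ⊢ Γ ⇒ Δ
  cut′ A (n , d) (m , e) = cut A n d m e ↭-refl

  cut A zero () m e π
  cut A (suc n) (up d) m e π = cut A n d m e π
  cut A (suc n) (init σ) m e π = m , permute (contract m e (π ⊙ prep _ σ)) (↭-sym σ)
  cut A (suc n) (L⊥ σ) m e π = 1 , L⊥ σ
  cut A (suc n) (L⊃ {B = Y} σ d₁ d₂) m e π =
    contract′ (L⊃′ ↭-refl (weaken′ (n , permute d₁ (↭-sym σ)))
                          (cut A n (permute (weaken d₂) (↭-sym (↭-insert [ Y ] σ))) m (weaken e)
                               (↭-insert [ Y ] π))) σ
  cut A (suc n) (L∧ {A = X} {B = Y} σ d) m e π =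
    contract′ (L∧′ ↭-refl (cut A n (permute (weaken d) (↭-sym (↭-insert (X ∷ Y ∷ []) σ))) m
                                  (weaken-++ˡ (X ∷ Y ∷ []) e) (↭-insert (X ∷ Y ∷ []) π))) σ
  cut A (suc n) (L∨ {A = X} {B = Y} σ d₁ d₂) m e π =
    contract′ (L∨′ ↭-refl (cut A n (permute (weaken d₁) (↭-sym (↭-insert [ X ] σ))) m (weaken e)
                                   (↭-insert [ X ] π))
                          (cut A n (permute (weaken d₂) (↭-sym (↭-insert [ Y ] σ))) m (weaken e)
                                   (↭-insert [ Y ] π))) σ
  cut A (suc n) (T□ {A = Y} t σ d) m e π =
    T□′ t σ (permute′ (cut A n (permute d (prep Y (↭-sym σ))) m (weaken e) (↭-insert [ Y ] π)) (prep Y σ))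
  cut A (suc n) (mod s◇L o σ d) m e π = suc n , mod s◇L o σ d
  cut A (suc n) (mod s□L o σ d) m e π = suc n , mod s□L o σ d
  cut A (suc n) (mod s□R o σ d) m e π = cut-RightIntro A n (intro□R o σ d) m e π
  cut A (suc n) (mod s◇R o σ d) m e π = cut-RightIntro A n (intro◇R o σ d) m e π
  cut A (suc n) (mod s◇Rᴰ o σ d) m e π = cut-RightIntro A n (intro◇Rᴰ o σ d) m e π
  cut A (suc n) (R⊃ d) m e π = cut-RightIntro A n (intro⊃ d) m e π
  cut A (suc n) (R∧ d₁ d₂) m e π = cut-RightIntro A n (intro∧ d₁ d₂) m e π
  cut A (suc n) (R∨₁ d) m e π = cut-RightIntro A n (intro∨₁ d) m e π
  cut A (suc n) (R∨₂ d) m e π = cut-RightIntro A n (intro∨₂ d) m e π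
  cut A (suc n) (T◇ t d) m e π = cut-RightIntro A n (introT◇ t d) m e π

  cut-RightIntro A n r zero () π
  cut-RightIntro A n r (suc m) (up e) π = cut-RightIntro A n r m e π
  cut-RightIntro A n r (suc m) (init σ) π with ↭-∷-inv (↭-sym π ⊙ σ)
  ... | inj₁ (refl , τ) = suc n , RightIntro⇒⊢ r
  ... | inj₂ (_ , τ , _) = 1 , init τ
  cut-RightIntro A n r (suc m) (L⊥ σ) π with ↭-∷-inv (↭-sym π ⊙ σ)
  cut-RightIntro A n () (suc m) (L⊥ σ) π | inj₁ (refl , τ)
  ... | inj₂ (_ , τ , _) = 1 , L⊥ τ
  cut-RightIntro A n r (suc m) (L⊃ {B = Y} σ e₁ e₂) π with ↭-∷-inv (↭-sym π ⊙ σ)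
  ... | inj₁ (refl , τ) =
    cut-principal A n r (elim⊃ (cut-RightIntro A n r m e₁ (prep _ (↭-sym τ))) (m , permute e₂ (prep Y (↭-sym τ))))
  ... | inj₂ (_ , τ , ρ) =
    contract′ (L⊃′ ↭-refl (weaken′ (cut-RightIntro A n r m e₁ (↭-exchange [] τ ρ)))
                          (cut-RightIntro A n (weaken-RightIntro r) m (weaken e₂) (↭-exchange [ Y ] τ ρ))) τ
  cut-RightIntro A n r (suc m) (L∧ {A = X} {B = Y} σ e) π with ↭-∷-inv (↭-sym π ⊙ σ)
  ... | inj₁ (refl , τ) = cut-principal A n r (elim∧ (m , permute e (prep X (prep Y (↭-sym τ)))))
  ... | inj₂ (_ , τ , ρ) =
    contract′ (L∧′ ↭-refl (cut-RightIntro A n (weaken-RightIntro (weaken-RightIntro r)) m (weaken e)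
                                           (↭-exchange (X ∷ Y ∷ []) τ ρ))) τ
  cut-RightIntro A n r (suc m) (L∨ {A = X} {B = Y} σ e₁ e₂) π with ↭-∷-inv (↭-sym π ⊙ σ)
  ... | inj₁ (refl , τ) =
    cut-principal A n r (elim∨ (m , permute e₁ (prep X (↭-sym τ))) (m , permute e₂ (prep Y (↭-sym τ))))
  ... | inj₂ (_ , τ , ρ) =
    contract′ (L∨′ ↭-refl (cut-RightIntro A n (weaken-RightIntro r) m (weaken e₁) (↭-exchange [ X ] τ ρ))
                          (cut-RightIntro A n (weaken-RightIntro r) m (weaken e₂) (↭-exchange [ Y ] τ ρ))) τ
  cut-RightIntro A n r (suc m) (R⊃ e) π =
    R⊃′ (cut-RightIntro A n (weaken-RightIntro r) m e (prep _ π ⊙ swap _ _ ↭-refl))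
  cut-RightIntro A n r (suc m) (R∧ e₁ e₂) π = R∧′ (cut-RightIntro A n r m e₁ π) (cut-RightIntro A n r m e₂ π)
  cut-RightIntro A n r (suc m) (R∨₁ e) π = R∨₁′ (cut-RightIntro A n r m e π)
  cut-RightIntro A n r (suc m) (R∨₂ e) π = R∨₂′ (cut-RightIntro A n r m e π)
  cut-RightIntro A n r (suc m) (T◇ t e) π = T◇′ t (cut-RightIntro A n r m e π)
  cut-RightIntro A n r (suc m) (T□ {A = Y} t σ e) π with ↭-∷-inv (↭-sym π ⊙ σ)
  ... | inj₁ (refl , τ) =
    cut-principal A n r (elimT□ t (cut-RightIntro A n (weaken-RightIntro r) m e
                                                  (swap Y A ↭-refl ⊙ prep A (prep Y (↭-sym τ)))))
  ... | inj₂ (_ , τ , ρ) =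
    T□′ t τ (permute′ (cut-RightIntro A n (weaken-RightIntro r) m e
                         (prep Y (prep _ ρ) ⊙ shifts (Y ∷ _ ∷ []) [ A ] ⊙ prep A (prep Y (↭-sym τ))))
                      (prep Y τ))
  cut-RightIntro A n r (suc m) (mod {S = S} {Γ′ = Γ′} {k = k} {P = P} {Q = Q} sh o σ e) π
    with split₃ P (□* S) Γ′ (↭-sym π ⊙ σ)
  ... | in₃ _ _ ρ = suc m , mod sh o ρ e
  ... | in₂ _ τ ρ with □*-↭-∷-inv S τ
  ...   | _ , _ , refl , μ , ν =
    cut-principal A n r (elim□ sh (Arity-resp-↭ L k μ o) (ρ ⊙ ++⁺ˡ P (++⁺ʳ Γ′ ν)) (m , permute e (++⁺ˡ Q μ)))
  cut-RightIntro A n r (suc m) (mod sh o σ e) π | in₁ _ τ ρ with Shape-◇-inv sh τ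
  ... | _ , refl , refl , refl , refl = cut-principal A n r (elim◇ sh o ρ (m , e))

  cut-principal (X ∧ Y) n (intro∧ d₁ d₂) (elim∧ (m , e)) =
    cut′ X (n , d₁) (cut Y n (weaken d₂) m e (swap X Y ↭-refl))
  cut-principal (X ∨ Y) n (intro∨₁ d) (elim∨ g₁ g₂) = cut′ X (n , d) g₁
  cut-principal (X ∨ Y) n (intro∨₂ d) (elim∨ g₁ g₂) = cut′ Y (n , d) g₂
  cut-principal (X ⊃ Y) n (intro⊃ d) (elim⊃ g₁ g₂) = cut′ Y (cut′ X g₁ (n , d)) g₂
  cut-principal (□ C) n {Γ = Γ} (intro□R {S = S₁} o₁ τ d) (elimT□ t g) = cut′ C (T□* t S₁ (n , weaken-++ʳ Γ d) τ) g
  cut-principal (□ C) n (intro□R {S = S₁} o₁ τ d) (elim□ {Q = Q} {S′ = S′} sh o σ (m , e)) =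
    principal-□R {S₁ = S₁} {S′ = S′} sh o₁ o τ σ
      (cut C n (weaken-++ˡ Q (weaken-++ʳ S′ d)) m (weaken-++ˡ S₁ e)
           (++⁺ˡ S₁ (↭-sym (↭-unshift Q)) ⊙ ↭-sym (↭-unshift S₁) ⊙ prep C (shifts S₁ Q)))
  cut-principal (◇ C) n (intro◇R {S = S₁} {Z = Z} o₁ τ d) (elim◇ {S = S} sh o σ (m , e)) =
    principal-◇R {S₁ = S₁} {S = S} sh o₁ o τ σ
      (cut C n (weaken-++ʳ S d) m (weaken-++ˡ (Z ∷ S₁) e) (↭-sym (↭-unshift (Z ∷ S₁))))
  cut-principal (◇ C) n (intro◇Rᴰ {S = S₁} o₁ τ d) (elim◇ {S = S} sh o σ (m , e)) =
    principal-◇Rᴰ {S₁ = S₁} {S = S} sh o₁ o τ σ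
      (cut C n (weaken-++ʳ S d) m (weaken-++ˡ S₁ e) (↭-sym (↭-unshift S₁)))
  cut-principal (◇ C) n {Γ = Γ} (introT◇ t d) (elim◇ {S = S} sh o σ (m , e)) =
    principal-T◇ {S = S} t sh σ (cut C n (weaken-++ˡ S d) m (weaken-++ʳ Γ e) ↭-refl)

-- From the bounded calculus to G.WL

data BaseRules (L : WL) : Base → Set where
  rulesM  : T (gM L) → BaseRules L baseM
  rulesMN : T (gM L) → T (gN L) → BaseRules L baseMN
  rulesMC : T (gC L) → BaseRules L baseMC
  rulesK  : T (gK L) → BaseRules L baseK

baseRules : ∀ L → BaseRules L (base L)
baseRules WM = rulesM tt
baseRules WMP = rulesM tt
baseRules WMD = rulesM tt
baseRules WMT = rulesM tt
baseRules WMN = rulesMN tt tt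
baseRules WMNP = rulesMN tt tt
baseRules WMND = rulesMN tt tt
baseRules WMNT = rulesMN tt tt
baseRules WMC = rulesMC tt
baseRules WMCD = rulesMC tt
baseRules WMCT = rulesMC tt
baseRules WK = rulesK tt
baseRules WKD = rulesK tt
baseRules WKT = rulesK tt

data SerialRules (L : WL) : Seriality → Set where
  rulesNone : SerialRules L nonserial
  rulesP    : T (gP L) → SerialRules L serialP
  rulesD    : T (gP L) → T (gD L) → SerialRules L serialD
  rulesCD   : T (gCD L) → SerialRules L serialCD

serialRules : ∀ L → SerialRules L (seriality L)
serialRules WMP = rulesP tt
serialRules WMNP = rulesP tt
serialRules WMD = rulesD tt tt
serialRules WMND = rulesD tt tt
serialRules WMCD = rulesCD tt
serialRules WKD = rulesCD tt
serialRules WM = rulesNone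
serialRules WMN = rulesNone
serialRules WMC = rulesNone
serialRules WK = rulesNone
serialRules WMT = rulesNone
serialRules WMNT = rulesNone
serialRules WMCT = rulesNone
serialRules WKT = rulesNone

module _ {L : WL} {n : ℕ} (⟦_⟧ : ∀ {Θ Δ} → L ⊢[ n ] Θ ⇒ Δ → L ⊢G Θ ⇒ Δ) where

  □R-rule : ∀ {b Θ S Γ′ B} → BaseRules L b → boxArity b (length S) → Θ ↭ □* S ++ Γ′ →
            L ⊢[ n ] S ⇒ just B → L ⊢G Θ ⇒ just (□ B)
  □R-rule {S = []} (rulesMN _ tN) _ σ d = N□ tN ⟦ d ⟧
  □R-rule {S = _ ∷ []} (rulesM tM) _ σ d = M□ tM σ ⟦ d ⟧
  □R-rule {S = _ ∷ []} (rulesMN tM _) _ σ d = M□ tM σ ⟦ d ⟧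
  □R-rule {S = _ ∷ _} (rulesMC tC) _ σ d = C□ tC σ ⟦ d ⟧
  □R-rule (rulesK tK) _ σ d = K□ tK σ ⟦ d ⟧

  ◇R-rule : ∀ {b Θ S Γ′ Z B} → BaseRules L b → diaArity b (length S) → Θ ↭ ◇ Z ∷ □* S ++ Γ′ →
            L ⊢[ n ] Z ∷ S ⇒ just B → L ⊢G Θ ⇒ just (◇ B)
  ◇R-rule {S = []} (rulesM tM) _ σ d = M◇ tM σ ⟦ d ⟧
  ◇R-rule {S = []} (rulesMN tM _) _ σ d = M◇ tM σ ⟦ d ⟧
  ◇R-rule (rulesMC tC) _ σ d = C◇ tC σ ⟦ d ⟧
  ◇R-rule (rulesK tK) _ σ d = K◇ tK σ ⟦ d ⟧

  -- The dual rules list the boxed premise formula first.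
  ◇L-rule : ∀ {b Θ S Γ′ Z Δ} → BaseRules L b → boxArity b (length S) → Θ ↭ ◇ Z ∷ □* S ++ Γ′ →
            L ⊢[ n ] Z ∷ S ⇒ nothing → L ⊢G Θ ⇒ Δ
  ◇L-rule {S = []} (rulesMN _ tN) _ σ d = N◇ tN σ ⟦ d ⟧
  ◇L-rule {S = _ ∷ []} (rulesM tM) _ σ d = DualM tM (σ ⊙ swap _ _ ↭-refl) ⟦ permute d (swap _ _ ↭-refl) ⟧
  ◇L-rule {S = _ ∷ []} (rulesMN tM _) _ σ d = DualM tM (σ ⊙ swap _ _ ↭-refl) ⟦ permute d (swap _ _ ↭-refl) ⟧
  ◇L-rule {S = _ ∷ _} (rulesMC tC) _ σ d = DualC tC (σ ⊙ swap _ _ ↭-refl) ⟦ permute d (swap _ _ ↭-refl) ⟧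
  ◇L-rule (rulesK tK) _ σ d = DualK tK σ ⟦ d ⟧

  ◇Rᴰ-rule : ∀ {s Θ S Γ′ B} → SerialRules L s → serial◇Arity s (length S) → Θ ↭ □* S ++ Γ′ →
             L ⊢[ n ] S ⇒ just B → L ⊢G Θ ⇒ just (◇ B)
  ◇Rᴰ-rule {S = []} (rulesP tP) _ σ d = P◇ tP ⟦ d ⟧
  ◇Rᴰ-rule {S = []} (rulesD tP _) _ σ d = P◇ tP ⟦ d ⟧
  ◇Rᴰ-rule {S = _ ∷ []} (rulesD _ tD) _ σ d = D tD σ ⟦ d ⟧
  ◇Rᴰ-rule (rulesCD tCD) _ σ d = CD tCD σ ⟦ d ⟧

  □L-rule : ∀ {s Θ S Γ′ Δ} → SerialRules L s → serial□Arity s (length S) → Θ ↭ □* S ++ Γ′ →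
            L ⊢[ n ] S ⇒ nothing → L ⊢G Θ ⇒ Δ
  □L-rule {Θ = Θ} {S = []} _ _ σ d = ⟦ permute (weaken⇒ (weaken-++ˡ Θ d)) (↭-reflexive (++-identityʳ Θ)) ⟧
  □L-rule {S = _ ∷ []} (rulesP tP) _ σ d = P□ tP σ ⟦ d ⟧
  □L-rule {S = _ ∷ []} (rulesD tP _) _ σ d = P□ tP σ ⟦ d ⟧
  □L-rule {S = _ ∷ _ ∷ []} (rulesD _ tD) _ σ d = D□ tD σ ⟦ d ⟧
  □L-rule {S = _ ∷ _} (rulesCD tCD) _ σ d = CD□ tCD σ ⟦ d ⟧

  modal-rule : ∀ {k P Q Δp Δ Θ S Γ′} → Shape k P Q Δp Δ → Arity L k (length S) →
               Θ ↭ P ++ □* S ++ Γ′ → L ⊢[ n ] Q ++ S ⇒ Δp → L ⊢G Θ ⇒ Δ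
  modal-rule s□R = □R-rule (baseRules L)
  modal-rule s◇R = ◇R-rule (baseRules L)
  modal-rule s◇L = ◇L-rule (baseRules L)
  modal-rule s◇Rᴰ = ◇Rᴰ-rule (serialRules L)
  modal-rule s□L = □L-rule (serialRules L)

⊢[]⇒⊢G : ∀ {L} n {Γ Δ} → L ⊢[ n ] Γ ⇒ Δ → L ⊢G Γ ⇒ Δ
⊢[]⇒⊢G zero ()
⊢[]⇒⊢G (suc n) (up d) = ⊢[]⇒⊢G n d
⊢[]⇒⊢G (suc n) (init σ) = init σ
⊢[]⇒⊢G (suc n) (L⊥ σ) = L⊥ σ
⊢[]⇒⊢G (suc n) (L⊃ σ d₁ d₂) = L⊃ σ (⊢[]⇒⊢G n d₁) (⊢[]⇒⊢G n d₂)
⊢[]⇒⊢G (suc n) (R⊃ d) = R⊃ (⊢[]⇒⊢G n d)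
⊢[]⇒⊢G (suc n) (R∧ d₁ d₂) = R∧ (⊢[]⇒⊢G n d₁) (⊢[]⇒⊢G n d₂)
⊢[]⇒⊢G (suc n) (L∧ σ d) = L∧ σ (⊢[]⇒⊢G n d)
⊢[]⇒⊢G (suc n) (R∨₁ d) = R∨₁ (⊢[]⇒⊢G n d)
⊢[]⇒⊢G (suc n) (R∨₂ d) = R∨₂ (⊢[]⇒⊢G n d)
⊢[]⇒⊢G (suc n) (L∨ σ d₁ d₂) = L∨ σ (⊢[]⇒⊢G n d₁) (⊢[]⇒⊢G n d₂)
⊢[]⇒⊢G (suc n) (mod sh o σ d) = modal-rule (⊢[]⇒⊢G n) sh o σ d
⊢[]⇒⊢G (suc n) (T□ t σ d) = T□ t σ (⊢[]⇒⊢G n d)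
⊢[]⇒⊢G (suc n) (T◇ t d) = T◇ t (⊢[]⇒⊢G n d)

⊢⇒⊢G : ∀ {L Γ Δ} → L ⊢ Γ ⇒ Δ → L ⊢G Γ ⇒ Δ
⊢⇒⊢G (n , d) = ⊢[]⇒⊢G n d

-- Hilbert derivations are derivable sequents

hN⇒boxArity-0 : ∀ L → T (hN L) → boxArity (base L) 0
hN⇒boxArity-0 WMN _ = tt
hN⇒boxArity-0 WK _ = tt
hN⇒boxArity-0 WMNP _ = tt
hN⇒boxArity-0 WMND _ = tt
hN⇒boxArity-0 WKD _ = tt
hN⇒boxArity-0 WMNT _ = tt
hN⇒boxArity-0 WKT _ = tt

hC⇒boxArity-2 : ∀ L → T (hC L) → boxArity (base L) 2
hC⇒boxArity-2 WMC _ = tt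
hC⇒boxArity-2 WK _ = tt
hC⇒boxArity-2 WMCD _ = tt
hC⇒boxArity-2 WKD _ = tt
hC⇒boxArity-2 WMCT _ = tt
hC⇒boxArity-2 WKT _ = tt

hC⇒diaArity-1 : ∀ L → T (hC L) → diaArity (base L) 1
hC⇒diaArity-1 WMC _ = tt
hC⇒diaArity-1 WK _ = tt
hC⇒diaArity-1 WMCD _ = tt
hC⇒diaArity-1 WKD _ = tt
hC⇒diaArity-1 WMCT _ = tt
hC⇒diaArity-1 WKT _ = tt

hP⇒serial◇Arity-0 : ∀ L → T (hP L) → serial◇Arity (seriality L) 0
hP⇒serial◇Arity-0 WMP _ = tt
hP⇒serial◇Arity-0 WMNP _ = tt
hP⇒serial◇Arity-0 WMD _ = tt
hP⇒serial◇Arity-0 WMCD _ = tt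

hD⇒serial◇Arity-1 : ∀ L → T (hD L) → serial◇Arity (seriality L) 1
hD⇒serial◇Arity-1 WMD _ = tt
hD⇒serial◇Arity-1 WMND _ = tt
hD⇒serial◇Arity-1 WMCD _ = tt
hD⇒serial◇Arity-1 WKD _ = tt

hT⇒gT : ∀ L → T (hT L) → T (gT L)
hT⇒gT WMT _ = tt
hT⇒gT WMNT _ = tt
hT⇒gT WMCT _ = tt
hT⇒gT WKT _ = tt

module _ {L : WL} where

  assumption : ∀ {X Γ} → X ∈ Γ → L ⊢ Γ ⇒ just X
  assumption {X} X∈Γ with Γ′ , τ ← ∈⇒↭∷ X∈Γ = permute′ (identity X Γ′) (↭-sym τ)

  hyp₀ : ∀ {X Γ} → L ⊢ X ∷ Γ ⇒ just X
  hyp₀ = assumption (here refl)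

  hyp₁ : ∀ {X Y Γ} → L ⊢ Y ∷ X ∷ Γ ⇒ just X
  hyp₁ = assumption (there (here refl))

  hyp₂ : ∀ {X Y Z Γ} → L ⊢ Z ∷ Y ∷ X ∷ Γ ⇒ just X
  hyp₂ = assumption (there (there (here refl)))

  modus-ponens : ∀ {Γ X Y} → L ⊢ Γ ⇒ just (X ⊃ Y) → L ⊢ Γ ⇒ just X → L ⊢ Γ ⇒ just Y
  modus-ponens {Γ} {X} {Y} f a = cut′ (X ⊃ Y) f (L⊃′ ↭-refl (weaken′ a) (identity Y Γ))

  falsum-elim : ∀ {Γ Δ} → L ⊢ Γ ⇒ just falsum → L ⊢ Γ ⇒ Δ
  falsum-elim g = cut′ falsum g L⊥′

  ⊢H⇒⊢ : ∀ {A} → L ⊢H A → L ⊢ [] ⇒ just A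
  ⊢H⇒⊢ ax-K = R⊃′ (R⊃′ hyp₁)
  ⊢H⇒⊢ ax-S = R⊃′ (R⊃′ (R⊃′ (modus-ponens (modus-ponens hyp₂ hyp₀) (modus-ponens hyp₁ hyp₀))))
  ⊢H⇒⊢ ax-∧E₁ = R⊃′ (L∧′ ↭-refl hyp₀)
  ⊢H⇒⊢ ax-∧E₂ = R⊃′ (L∧′ ↭-refl hyp₁)
  ⊢H⇒⊢ ax-∧I = R⊃′ (R⊃′ (R∧′ hyp₁ hyp₀))
  ⊢H⇒⊢ ax-∨I₁ = R⊃′ (R∨₁′ hyp₀)
  ⊢H⇒⊢ ax-∨I₂ = R⊃′ (R∨₂′ hyp₀)
  ⊢H⇒⊢ ax-∨E = R⊃′ (R⊃′ (R⊃′ (L∨′ ↭-refl (modus-ponens hyp₂ hyp₀) (modus-ponens hyp₁ hyp₀))))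
  ⊢H⇒⊢ ax-⊥E = R⊃′ L⊥′
  ⊢H⇒⊢ (mp f a) = modus-ponens (⊢H⇒⊢ f) (⊢H⇒⊢ a)
  ⊢H⇒⊢ (dual∧ {A}) =
    R⊃′ (L∧′ ↭-refl (mod′ {S = [ A ]} s◇L (boxArity-1 (base L)) (swap _ _ ↭-refl)
                          (falsum-elim (modus-ponens hyp₀ hyp₁))))
  ⊢H⇒⊢ (mon□ {A} f) =
    R⊃′ (mod′ {S = [ A ]} s□R (boxArity-1 (base L)) ↭-refl (modus-ponens (weaken′ (⊢H⇒⊢ f)) hyp₀))
  ⊢H⇒⊢ (mon◇ f) =
    R⊃′ (mod′ {S = []} s◇R (diaArity-0 (base L)) ↭-refl (modus-ponens (weaken′ (⊢H⇒⊢ f)) hyp₀))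
  ⊢H⇒⊢ (axN□ t) = mod′ {S = []} s□R (hN⇒boxArity-0 L t) ↭-refl (R⊃′ L⊥′)
  ⊢H⇒⊢ (axC□ {A} {B} t) = R⊃′ (L∧′ ↭-refl (mod′ {S = A ∷ B ∷ []} s□R (hC⇒boxArity-2 L t) ↭-refl (R∧′ hyp₀ hyp₁)))
  ⊢H⇒⊢ (axK◇ {A} t) = R⊃′ (R⊃′ (mod′ {S = [ A ⊃ _ ]} s◇R (hC⇒diaArity-1 L t) ↭-refl (modus-ponens hyp₁ hyp₀)))
  ⊢H⇒⊢ (axP◇ t) = mod′ {S = []} s◇Rᴰ (hP⇒serial◇Arity-0 L t) ↭-refl (R⊃′ L⊥′)
  ⊢H⇒⊢ (axD {A} t) = R⊃′ (mod′ {S = [ A ]} s◇Rᴰ (hD⇒serial◇Arity-1 L t) ↭-refl hyp₀)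
  ⊢H⇒⊢ (axT□ t) = R⊃′ (T□′ (hT⇒gT L t) ↭-refl hyp₀)
  ⊢H⇒⊢ (axT◇ t) = R⊃′ (T◇′ (hT⇒gT L t) hyp₀)

  ⋀-intro : ∀ A Γ → L ⊢ A ∷ Γ ⇒ just (⋀ (A ∷ Γ))
  ⋀-intro A [] = hyp₀
  ⋀-intro A (B ∷ Γ) = R∧′ hyp₀ (weaken′ (⋀-intro B Γ))

  ⋁-elim : ∀ {Γ} Δ → L ⊢ Γ ⇒ just (⋁ Δ) → L ⊢ Γ ⇒ Δ
  ⋁-elim (just B) g = g
  ⋁-elim nothing g = falsum-elim g

  fmla⇒⊢ : ∀ Γ Δ → L ⊢H fmla Γ Δ → L ⊢ Γ ⇒ Δ
  fmla⇒⊢ [] Δ h = ⋁-elim Δ (⊢H⇒⊢ h)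
  fmla⇒⊢ (A ∷ Γ) Δ h =
    ⋁-elim Δ (modus-ponens (permute′ (weaken-++ˡ′ (A ∷ Γ) (⊢H⇒⊢ h)) (↭-reflexive (++-identityʳ (A ∷ Γ))))
                           (⋀-intro A Γ))

-- Derivable sequents are Hilbert derivations

gN⇒hN : ∀ L → T (gN L) → T (hN L)
gN⇒hN WMN _ = tt
gN⇒hN WMNP _ = tt
gN⇒hN WMND _ = tt
gN⇒hN WMNT _ = tt

gC⇒hC : ∀ L → T (gC L) → T (hC L)
gC⇒hC WMC _ = tt
gC⇒hC WMCD _ = tt
gC⇒hC WMCT _ = tt

gK⇒hN : ∀ L → T (gK L) → T (hN L)
gK⇒hN WK _ = tt
gK⇒hN WKD _ = tt
gK⇒hN WKT _ = tt

gK⇒hC : ∀ L → T (gK L) → T (hC L)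
gK⇒hC WK _ = tt
gK⇒hC WKD _ = tt
gK⇒hC WKT _ = tt

gT⇒hT : ∀ L → T (gT L) → T (hT L)
gT⇒hT WMT _ = tt
gT⇒hT WMNT _ = tt
gT⇒hT WMCT _ = tt
gT⇒hT WKT _ = tt

gD⇒hD : ∀ L → T (gD L) → T (hD L)
gD⇒hD WMD _ = tt
gD⇒hD WMND _ = tt

gCD⇒hC : ∀ L → T (gCD L) → T (hC L)
gCD⇒hC WMCD _ = tt
gCD⇒hC WKD _ = tt

gCD⇒hD : ∀ L → T (gCD L) → T (hD L)
gCD⇒hD WMCD _ = tt
gCD⇒hD WKD _ = tt

gP⇒◇⊤ : ∀ L → T (gP L) → L ⊢H ◇ ⊤ᶠ
gP⇒◇⊤ WMP _ = axP◇ tt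
gP⇒◇⊤ WMNP _ = axP◇ tt
gP⇒◇⊤ WMD _ = axP◇ tt
gP⇒◇⊤ WMND _ = mp (axD tt) (axN□ tt)

gCD⇒◇⊤ : ∀ L → T (gCD L) → L ⊢H ◇ ⊤ᶠ
gCD⇒◇⊤ WMCD _ = axP◇ tt
gCD⇒◇⊤ WKD _ = mp (axD tt) (axN□ tt)

∈-head : ∀ {Θ Γ} {X : Fm} → Θ ↭ X ∷ Γ → X ∈ Θ
∈-head σ = ∈-resp-↭ (↭-sym σ) (here refl)

∈-second : ∀ {Θ Γ} {X Y : Fm} → Θ ↭ X ∷ Y ∷ Γ → Y ∈ Θ
∈-second σ = ∈-resp-↭ (↭-sym σ) (there (here refl))

□∈ : ∀ {Θ R x} Q S → Θ ↭ Q ++ □* S ++ R → x ∈ S → □ x ∈ Θ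
□∈ Q S σ x∈S = ∈-resp-↭ (↭-sym σ) (∈-++⁺ʳ Q (∈-++⁺ˡ (∈-map⁺ □_ x∈S)))

module _ {L : WL} where

  infix 2 _⊩_
  infixl 5 _·_
  data _⊩_ (Γ : List Fm) : Fm → Set where
    hyp : ∀ {A} → A ∈ Γ → Γ ⊩ A
    thm : ∀ {A} → L ⊢H A → Γ ⊩ A
    _·_ : ∀ {A B} → Γ ⊩ A ⊃ B → Γ ⊩ A → Γ ⊩ B

  ⊃-refl : ∀ {A} → L ⊢H A ⊃ A
  ⊃-refl {A} = mp (mp (ax-S {A = A} {B = A ⊃ A} {C = A}) ax-K) ax-K

  deduction : ∀ {Γ A B} → A ∷ Γ ⊩ B → Γ ⊩ A ⊃ B
  deduction (hyp (here refl)) = thm ⊃-refl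
  deduction (hyp (there p)) = thm ax-K · hyp p
  deduction (thm x) = thm ax-K · thm x
  deduction (f · a) = thm ax-S · deduction f · deduction a

  ⊩-subst : ∀ {Γ Γ′ A} → Γ ⊩ A → (∀ {x} → x ∈ Γ → Γ′ ⊩ x) → Γ′ ⊩ A
  ⊩-subst (hyp p) h = h p
  ⊩-subst (thm x) h = thm x
  ⊩-subst (f · a) h = ⊩-subst f h · ⊩-subst a h

  ⊩-closed : ∀ {A} → [] ⊩ A → L ⊢H A
  ⊩-closed (thm x) = x
  ⊩-closed (f · a) = mp (⊩-closed f) (⊩-closed a)

  ⊩-permute : ∀ {Γ Γ′ A} → Γ ⊩ A → Γ ↭ Γ′ → Γ′ ⊩ A
  ⊩-permute d ρ = ⊩-subst d (λ p → hyp (∈-resp-↭ ρ p))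

  ⊩⇒⊃ : ∀ {A B} → [ A ] ⊩ B → L ⊢H A ⊃ B
  ⊩⇒⊃ d = ⊩-closed (deduction d)

  ∧-intro : ∀ {Γ A B} → Γ ⊩ A → Γ ⊩ B → Γ ⊩ A ∧ B
  ∧-intro a b = thm ax-∧I · a · b

  ¬¬-intro : ∀ {B} → L ⊢H B ⊃ ¬ᶠ ¬ᶠ B
  ¬¬-intro = ⊩⇒⊃ (deduction (hyp (here refl) · hyp (there (here refl))))

  dual-absurd : ∀ {Γ X Y} → Γ ⊩ □ X → L ⊢H X ⊃ ¬ᶠ Y → Γ ⊩ ◇ Y → Γ ⊩ falsum
  dual-absurd □X X⊃¬Y ◇Y = thm dual∧ · ∧-intro (thm (mon□ X⊃¬Y) · □X) (thm (mon◇ ¬¬-intro) · ◇Y)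

  ⋀-elim : ∀ A Γ {x} → x ∈ A ∷ Γ → [ ⋀ (A ∷ Γ) ] ⊩ x
  ⋀-elim A [] (here refl) = hyp (here refl)
  ⋀-elim A (B ∷ Γ) (here refl) = thm ax-∧E₁ · hyp (here refl)
  ⋀-elim A (B ∷ Γ) (there p) =
    ⊩-subst (⋀-elim B Γ p) λ { (here refl) → thm ax-∧E₂ · hyp (here refl) }

  ⋀⊃ : ∀ {A Γ X} → A ∷ Γ ⊩ X → L ⊢H ⋀ (A ∷ Γ) ⊃ X
  ⋀⊃ {A} {Γ} d = ⊩⇒⊃ (⊩-subst d (⋀-elim A Γ))

  □⋀ : ∀ {Θ} → T (hC L) → ∀ A Γ → (∀ {x} → x ∈ A ∷ Γ → □ x ∈ Θ) → Θ ⊩ □ ⋀ (A ∷ Γ)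
  □⋀ t A [] h = hyp (h (here refl))
  □⋀ t A (B ∷ Γ) h = thm (axC□ t) · ∧-intro (hyp (h (here refl))) (□⋀ t B Γ (λ p → h (there p)))

  ⊢G⇒⊩ : ∀ {Γ Δ} → L ⊢G Γ ⇒ Δ → Γ ⊩ ⋁ Δ
  ⊢G⇒⊩ (init σ) = hyp (∈-head σ)
  ⊢G⇒⊩ (L⊥ σ) = thm ax-⊥E · hyp (∈-head σ)
  ⊢G⇒⊩ (L⊃ σ d₁ d₂) =
    ⊩-permute (⊩-subst (⊢G⇒⊩ d₂) λ { (here refl) → hyp (here refl) · ⊢G⇒⊩ d₁ ; (there p) → hyp (there p) })
              (↭-sym σ)
  ⊢G⇒⊩ (R⊃ d) = deduction (⊢G⇒⊩ d)
  ⊢G⇒⊩ (R∧ d₁ d₂) = ∧-intro (⊢G⇒⊩ d₁) (⊢G⇒⊩ d₂)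
  ⊢G⇒⊩ (L∧ σ d) =
    ⊩-permute (⊩-subst (⊢G⇒⊩ d) λ { (here refl) → thm ax-∧E₁ · hyp (here refl)
                                  ; (there (here refl)) → thm ax-∧E₂ · hyp (here refl)
                                  ; (there (there p)) → hyp (there p) })
              (↭-sym σ)
  ⊢G⇒⊩ (R∨₁ d) = thm ax-∨I₁ · ⊢G⇒⊩ d
  ⊢G⇒⊩ (R∨₂ d) = thm ax-∨I₂ · ⊢G⇒⊩ d
  ⊢G⇒⊩ (L∨ σ d₁ d₂) =
    ⊩-permute (thm ax-∨E · deduction (⊩-subst (⊢G⇒⊩ d₁) under-∨) · deduction (⊩-subst (⊢G⇒⊩ d₂) under-∨)
                         · hyp (here refl))
              (↭-sym σ)
    where
    under-∨ : ∀ {X Y Γ x} → x ∈ X ∷ Γ → X ∷ Y ∷ Γ ⊩ x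
    under-∨ (here refl) = hyp (here refl)
    under-∨ (there p) = hyp (there (there p))
  ⊢G⇒⊩ (M□ t σ d) = thm (mon□ (⊩⇒⊃ (⊢G⇒⊩ d))) · hyp (∈-head σ)
  ⊢G⇒⊩ (M◇ t σ d) = thm (mon◇ (⊩⇒⊃ (⊢G⇒⊩ d))) · hyp (∈-head σ)
  ⊢G⇒⊩ (DualM t σ d) =
    thm ax-⊥E · dual-absurd (hyp (∈-head σ))
                            (⊩-closed (deduction (deduction (⊩-permute (⊢G⇒⊩ d) (swap _ _ ↭-refl)))))
                            (hyp (∈-second σ))
  ⊢G⇒⊩ (N□ t d) = thm (mon□ (mp ax-K (⊩-closed (⊢G⇒⊩ d)))) · thm (axN□ (gN⇒hN L t))
  ⊢G⇒⊩ (N◇ t σ d) = thm ax-⊥E · dual-absurd (thm (axN□ (gN⇒hN L t))) (mp ax-K (⊩⇒⊃ (⊢G⇒⊩ d))) (hyp (∈-head σ))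
  ⊢G⇒⊩ (C□ {Γ = Γ} {A = A} t σ d) =
    thm (mon□ (⋀⊃ (⊢G⇒⊩ d)))
    · □⋀ (gC⇒hC L t) A Γ λ { (here refl) → ∈-head σ ; (there p) → □∈ [ _ ] Γ σ p }
  ⊢G⇒⊩ (C◇ {Γ = []} t σ d) = thm (mon◇ (⊩⇒⊃ (⊢G⇒⊩ d))) · hyp (∈-head σ)
  ⊢G⇒⊩ (C◇ {Γ = C ∷ Γ} t σ d) =
    thm (axK◇ (gC⇒hC L t)) · (thm (mon□ (⋀⊃ (deduction (⊢G⇒⊩ d)))) · □⋀ (gC⇒hC L t) C Γ (□∈ [ _ ] (C ∷ Γ) σ))
    · hyp (∈-head σ)
  ⊢G⇒⊩ (DualC {Γ = Γ} {A = A} t σ d) =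
    thm ax-⊥E · dual-absurd (□⋀ (gC⇒hC L t) A Γ λ { (here refl) → ∈-head σ ; (there p) → □∈ (_ ∷ _ ∷ []) Γ σ p })
                            (⋀⊃ (deduction (⊩-permute (⊢G⇒⊩ d) (swap _ _ ↭-refl))))
                            (hyp (∈-second σ))
  ⊢G⇒⊩ (K□ {Γ = []} t σ d) = thm (mon□ (mp ax-K (⊩-closed (⊢G⇒⊩ d)))) · thm (axN□ (gK⇒hN L t))
  ⊢G⇒⊩ (K□ {Γ = C ∷ Γ} t σ d) = thm (mon□ (⋀⊃ (⊢G⇒⊩ d))) · □⋀ (gK⇒hC L t) C Γ (□∈ [] (C ∷ Γ) σ)
  ⊢G⇒⊩ (K◇ {Γ = []} t σ d) = thm (mon◇ (⊩⇒⊃ (⊢G⇒⊩ d))) · hyp (∈-head σ)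
  ⊢G⇒⊩ (K◇ {Γ = C ∷ Γ} t σ d) =
    thm (axK◇ (gK⇒hC L t)) · (thm (mon□ (⋀⊃ (deduction (⊢G⇒⊩ d)))) · □⋀ (gK⇒hC L t) C Γ (□∈ [ _ ] (C ∷ Γ) σ))
    · hyp (∈-head σ)
  ⊢G⇒⊩ (DualK {Γ = []} t σ d) =
    thm ax-⊥E · dual-absurd (thm (axN□ (gK⇒hN L t))) (mp ax-K (⊩⇒⊃ (⊢G⇒⊩ d))) (hyp (∈-head σ))
  ⊢G⇒⊩ (DualK {Γ = C ∷ Γ} t σ d) =
    thm ax-⊥E · dual-absurd (□⋀ (gK⇒hC L t) C Γ (□∈ [ _ ] (C ∷ Γ) σ)) (⋀⊃ (deduction (⊢G⇒⊩ d))) (hyp (∈-head σ))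
  ⊢G⇒⊩ (T□ t σ d) =
    ⊩-permute (⊩-subst (⊢G⇒⊩ d) λ { (here refl) → thm (axT□ (gT⇒hT L t)) · hyp (here refl) ; (there p) → hyp p })
              (↭-sym σ)
  ⊢G⇒⊩ (T◇ t d) = thm (axT◇ (gT⇒hT L t)) · ⊢G⇒⊩ d
  ⊢G⇒⊩ (P□ t σ d) =
    thm ax-⊥E · dual-absurd (hyp (∈-head σ))
                            (⊩-closed (deduction (deduction (⊩-subst (⊢G⇒⊩ d) weaken-⊤))))
                            (thm (gP⇒◇⊤ L t))
    where
    weaken-⊤ : ∀ {x} → x ∈ [ _ ] → ⊤ᶠ ∷ _ ∷ [] ⊩ x
    weaken-⊤ (here refl) = hyp (there (here refl))
  ⊢G⇒⊩ (P◇ t d) = thm (mon◇ (mp ax-K (⊩-closed (⊢G⇒⊩ d)))) · thm (gP⇒◇⊤ L t)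
  ⊢G⇒⊩ (D t σ d) = thm (mon◇ (⊩⇒⊃ (⊢G⇒⊩ d))) · (thm (axD (gD⇒hD L t)) · hyp (∈-head σ))
  ⊢G⇒⊩ (D□ t σ d) =
    thm ax-⊥E · dual-absurd (hyp (∈-second σ)) (⊩-closed (deduction (deduction (⊢G⇒⊩ d))))
                            (thm (axD (gD⇒hD L t)) · hyp (∈-head σ))
  ⊢G⇒⊩ (CD {Γ = []} t σ d) = thm (mon◇ (mp ax-K (⊩-closed (⊢G⇒⊩ d)))) · thm (gCD⇒◇⊤ L t)
  ⊢G⇒⊩ (CD {Γ = C ∷ Γ} t σ d) =
    thm (mon◇ (⋀⊃ (⊢G⇒⊩ d))) · (thm (axD (gCD⇒hD L t)) · □⋀ (gCD⇒hC L t) C Γ (□∈ [] (C ∷ Γ) σ))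
  ⊢G⇒⊩ (CD□ {Γ = []} t σ d) = thm ax-⊥E · thm (⊩-closed (⊢G⇒⊩ d))
  ⊢G⇒⊩ (CD□ {Γ = C ∷ Γ} t σ d) =
    thm ax-⊥E · dual-absurd □⋀Γ (⊩⇒⊃ (deduction (thm (⋀⊃ (⊢G⇒⊩ d)) · hyp (there (here refl)))))
                            (thm (axD (gCD⇒hD L t)) · □⋀Γ)
    where
    □⋀Γ = □⋀ (gCD⇒hC L t) C Γ (□∈ [] (C ∷ Γ) σ)

  ⊢G⇒fmla : ∀ Γ Δ → L ⊢G Γ ⇒ Δ → L ⊢H fmla Γ Δ
  ⊢G⇒fmla [] Δ d = ⊩-closed (⊢G⇒⊩ d)
  ⊢G⇒fmla (A ∷ Γ) Δ d = ⋀⊃ (⊢G⇒⊩ d)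

theorem3p4 : (L : WL) (Γ : List Fm) (Δ : Maybe Fm) →
    (L ⊢G Γ ⇒ Δ) ⇔ (L ⊢H fmla Γ Δ)
theorem3p4 L Γ Δ = mk⇔ (⊢G⇒fmla Γ Δ) (λ h → ⊢⇒⊢G (fmla⇒⊢ Γ Δ h))
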